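{- For $n>1$ and $k\ge 1$, let $c_{n,k}$ be the number of indecomposable permutations of $\mathcal S_n$ with $k$ cycles (equivalently, with $k$ left-to-right maxima). Then $$c_{n,k}= s_{n,k} -\sum_{p=1}^{n-1} \sum_{i=1}^{\min(k,p)} c_{p,i}\,s_{n-p,k-i} \qquad\text{and}\qquad c_{n,k}= \sum_{p=1}^{n-1} \sum_{i=1}^{\min(k,p)} p\, c_{p,i}\,s_{n-p-1,k-i},$$ where $s_{m,j}$ is the number of permutations of $\mathcal S_m$ with $j$ cycles.
   Context: A permutation $a_1,\dots,a_n$ of $\{1,\dots,n\}$ (with $a_i$ the image of $i$) is decomposable if there is $p<n$ with $1\le a_i\le p$ for all $i\le p$, indecomposable otherwise. $a_i$ is a left-to-right maximum if $a_j<a_i$ for all $j<i$. The numbers $s_{m,j}$ (unsigned Stirling numbers of the first kind) use the conventions $s_{0,0}=1$, $s_{0,j}=0$ for $j\neq 0$, and $s_{m,0}=0$ for $m>0$; $c_{p,i}$ is defined for $p\ge1$ (with $c_{1,1}=1$). -}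

module Defs where

open import Data.Nat using (ℕ; zero; suc; _+_; _*_; _∸_; _<ᵇ_; _⊓_)
open import Data.Bool using (Bool; true; false; _∧_; _∨_; not)
open import Data.Fin using (Fin; toℕ)
open import Data.Fin.Properties using (_≟_)
open import Data.Vec using (Vec; []; _∷_; lookup)
open import Data.List using (List; []; _∷_; [_]; map; concatMap; allFin; filter; length; upTo)
open import Data.Bool.ListAction using (all; any)
open import Data.Nat.ListAction using (sum)
open import Relation.Nullary.Decidable using (⌊_⌋)

-- A permutation a₁,…,aₙ of {1,…,n} is represented by its one-line notation,
-- stored 0-based: σ : Vec (Fin n) n with lookup σ i = a_{i+1} - 1.

allVecs : (n m : ℕ) → List (Vec (Fin n) m)
allVecs n zero    = [ [] ]
allVecs n (suc m) = concatMap (λ x → map (x ∷_) (allVecs n m)) (allFin n)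

-- i ↦ aᵢ is injective (hence bijective, Fin n being finite)
isPerm : ∀ {n} → Vec (Fin n) n → Bool
isPerm {n} σ =
  all (λ i → all (λ j → not ⌊ lookup σ i ≟ lookup σ j ⌋ ∨ ⌊ i ≟ j ⌋) (allFin n)) (allFin n)

perms : (n : ℕ) → List (Vec (Fin n) n)
perms n = filter (λ σ → Data.Bool.T? (isPerm σ)) (allVecs n n)
  where import Data.Bool

interval : ℕ → ℕ → List ℕ
interval a b = map (a +_) (upTo (suc b ∸ a))

-- Σ_{j=a}^{b} f j   (empty sum = 0 when b < a)
sumFT : ℕ → ℕ → (ℕ → ℕ) → ℕ
sumFT a b f = sum (map f (interval a b))

-- decomposable: there is p < n (p ≥ 1) with 1 ≤ aᵢ ≤ p for all i ≤ p.
-- In 0-based terms: ∀ i with toℕ i < p, toℕ (σ i) < p.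
isDecomposable : ∀ {n} → Vec (Fin n) n → Bool
isDecomposable {n} σ =
  any (λ p → all (λ i → not (toℕ i <ᵇ p) ∨ (toℕ (lookup σ i) <ᵇ p)) (allFin n))
      (interval 1 (n ∸ 1))

isIndecomposable : ∀ {n} → Vec (Fin n) n → Bool
isIndecomposable σ = not (isDecomposable σ)

iter : ∀ {n} → Vec (Fin n) n → ℕ → Fin n → Fin n
iter σ zero    i = i
iter σ (suc t) i = lookup σ (iter σ t i)

-- i is the smallest element of its cycle (the orbit of i is {σ^t i | 1 ≤ t ≤ n})
isCycleMin : ∀ {n} → Vec (Fin n) n → Fin n → Bool
isCycleMin {n} σ i = all (λ t → not (toℕ (iter σ t i) <ᵇ toℕ i)) (interval 1 n)

-- number of cycles of σ = number of cycles, counted by their minimal elements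
numCycles : ∀ {n} → Vec (Fin n) n → ℕ
numCycles {n} σ = length (filter (λ i → Data.Bool.T? (isCycleMin σ i)) (allFin n))
  where import Data.Bool

s : ℕ → ℕ → ℕ
s m j = length (filter (λ σ → numCycles σ Data.Nat.≟ j) (perms m))
  where import Data.Nat

c : ℕ → ℕ → ℕ
c n k = length (filter (λ σ → Data.Bool.T? (isIndecomposable σ ∧ ⌊ numCycles σ Data.Nat.≟ k ⌋)) (perms n))
  where import Data.Bool
        import Data.Nat

-- Cut a permutation σ ∈ S_n at its first block, the least p ≥ 1 such that σ maps
-- {1,…,p} onto itself. Then σ = τ ⊕ ρ for a unique indecomposable τ ∈ S_p and an
-- arbitrary ρ ∈ S_{n−p}, the cycles of σ being those of τ and of ρ, and σ is
-- indecomposable exactly when p = n; counting S_n by first block gives the first identity.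
-- For the second, removing n from its cycle turns an indecomposable σ ∈ S_n into
-- σ′ ∈ S_{n−1} with as many cycles, together with the predecessor x of n. Splicing n
-- back in after x yields an indecomposable permutation exactly when x lies in the
-- first block of σ′, so each σ′ with first block p arises p times, and those σ′ are
-- counted by the first decomposition.

module Submission where

open import Defs
open import Data.Bool using (Bool; true; false; _∧_; _∨_; not; T; if_then_else_)
open import Data.Bool.ListAction using (all)
open import Data.Bool.Properties using (T?; T-≡; T-not-≡; T-∧; ∧-assoc; ∧-comm; ∧-identityʳ; ∧-zeroʳ)
open import Data.Empty using (⊥-elim)
open import Data.Fin using (Fin; toℕ; zero; suc; punchOut; _↑ˡ_; _↑ʳ_; splitAt; inject₁; fromℕ)
import Data.Fin.Properties as Fin
open import Data.Fin.Relation.Unary.Top using (View; view; ‵fromℕ; ‵inject₁; view-fromℕ; view-inject₁)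
open import Data.List
  using (List; []; _∷_; _++_; [_]; map; filter; length; concatMap; upTo; tabulate; allFin;
         cartesianProduct; cartesianProductWith)
open import Data.List.Membership.Propositional using (_∈_; lose; find)
open import Data.List.Membership.Propositional.Properties
  using (∈-filter⁺; ∈-filter⁻; ∈-map⁺; ∈-map⁻; ∈-allFin; ∈-upTo⁺; ∈-upTo⁻;
         ∈-cartesianProduct⁺; ∈-cartesianProductWith⁺)
open import Data.List.Membership.Propositional.Properties.WithK using (unique∧set⇒bag)
open import Data.List.Properties using (length-map; length-tabulate; map-tabulate; map-++; applyUpTo-∷ʳ)
open import Data.List.Relation.Binary.BagAndSetEquality using (∼bag⇒↭)
open import Data.List.Relation.Binary.Permutation.Propositional.Properties using (↭-length)
open import Data.List.Relation.Unary.All as All using ([]; _∷_)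
import Data.List.Relation.Unary.All.Properties as All
open import Data.List.Relation.Unary.AllPairs using ([]; _∷_)
open import Data.List.Relation.Unary.Any using (here; there)
import Data.List.Relation.Unary.Any.Properties as Any
open import Data.List.Relation.Unary.Unique.Propositional using (Unique)
import Data.List.Relation.Unary.Unique.Propositional.Properties as Unique
open import Data.Nat
  using (ℕ; zero; suc; _+_; _*_; _∸_; _≤_; _<_; _⊓_; _<ᵇ_; _≡ᵇ_; z≤n; s≤s; s≤s⁻¹; _≤?_; _<?_)
open import Data.Nat.Induction using (<-rec)
open import Data.Nat.ListAction using (sum)
open import Data.Nat.ListAction.Properties using (sum-++)
open import Data.Nat.Properties
open import Algebra.Properties.CommutativeSemigroup +-commutativeSemigroup using (interchange)
open import Data.Product using (_×_; _,_; proj₁; proj₂; ∃; map₂)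
open import Data.Product.Function.NonDependent.Propositional using (_×-⇔_)
open import Data.Sum using (_⊎_; inj₁; inj₂; [_,_]′)
open import Data.Vec using (Vec; lookup) renaming (tabulate to tabulateᵛ; [] to []ᵛ; _∷_ to _∷ᵛ_)
import Data.Vec.Properties as Vec
open import Function using (id; _∘_; _⇔_; mk⇔; Equivalence)
open import Function.Definitions using (Injective)
open import Function.Properties.Equivalence using () renaming (trans to ⇔-trans)
open import Level using (Level)
open import Relation.Binary using (tri<; tri≈; tri>)
open import Relation.Binary.PropositionalEquality hiding ([_])
open import Relation.Nullary using (¬_; yes; no; does)
open import Relation.Nullary.Decidable using (⌊_⌋; isYes≗does; toWitness; fromWitness)
open import Relation.Unary using (Pred; Decidable)

private variable
  ℓ ℓ′ ℓ″ : Level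
  A : Set ℓ
  B : Set ℓ′
  C : Set ℓ″

-- Counting with Boolean predicates

indicator : Bool → ℕ
indicator true  = 1
indicator false = 0

count : (A → Bool) → List A → ℕ
count P []       = 0
count P (x ∷ xs) = indicator (P x) + count P xs

length-filter : {P : Pred A ℓ″} (P? : Decidable P) (xs : List A) →
                length (filter P? xs) ≡ count (does ∘ P?) xs
length-filter P? []       = refl
length-filter P? (x ∷ xs) with does (P? x)
... | true  = cong suc (length-filter P? xs)
... | false = length-filter P? xs

count-filter : (P Q : A → Bool) (xs : List A) →
               count Q (filter (T? ∘ P) xs) ≡ count (λ x → P x ∧ Q x) xs
count-filter P Q []       = refl
count-filter P Q (x ∷ xs) with P x
... | true  = cong (indicator (Q x) +_) (count-filter P Q xs)
... | false = count-filter P Q xs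

count-cong : {P Q : A → Bool} (xs : List A) → (∀ x → P x ≡ Q x) → count P xs ≡ count Q xs
count-cong []       P≗Q = refl
count-cong (x ∷ xs) P≗Q = cong₂ _+_ (cong indicator (P≗Q x)) (count-cong xs P≗Q)

count-++ : (P : A → Bool) (xs ys : List A) → count P (xs ++ ys) ≡ count P xs + count P ys
count-++ P []       ys = refl
count-++ P (x ∷ xs) ys = trans (cong (indicator (P x) +_) (count-++ P xs ys))
                               (sym (+-assoc (indicator (P x)) _ _))

count-map : (P : B → Bool) (f : A → B) (xs : List A) → count P (map f xs) ≡ count (P ∘ f) xs
count-map P f []       = refl
count-map P f (x ∷ xs) = cong (indicator (P (f x)) +_) (count-map P f xs)

count≤length : (P : A → Bool) (xs : List A) → count P xs ≤ length xs
count≤length P []       = z≤n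
count≤length P (x ∷ xs) with P x
... | true  = s≤s (count≤length P xs)
... | false = m≤n⇒m≤1+n (count≤length P xs)

count-pos : (P : A → Bool) {xs : List A} {x : A} → x ∈ xs → T (P x) → 0 < count P xs
count-pos P {y ∷ _}  (here refl) Px with P y
... | true = s≤s z≤n
count-pos P {y ∷ xs} (there x∈) Px = ≤-trans (count-pos P x∈ Px) (m≤n+m _ (indicator (P y)))

indicator-∧ : ∀ x y → indicator (x ∧ y) ≡ indicator x * indicator y
indicator-∧ true  y = sym (+-identityʳ (indicator y))
indicator-∧ false y = refl

count-cartesianProduct : (P : A → Bool) (Q : B → Bool) (xs : List A) (ys : List B) →
  count (λ z → P (proj₁ z) ∧ Q (proj₂ z)) (cartesianProduct xs ys) ≡ count P xs * count Q ys
count-cartesianProduct P Q []       ys = refl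
count-cartesianProduct P Q (x ∷ xs) ys = begin
    count PQ (map (x ,_) ys ++ cartesianProduct xs ys)
  ≡⟨ count-++ PQ (map (x ,_) ys) _ ⟩
    count PQ (map (x ,_) ys) + count PQ (cartesianProduct xs ys)
  ≡⟨ cong₂ _+_ (trans (count-map PQ (x ,_) ys) (row ys)) (count-cartesianProduct P Q xs ys) ⟩
    indicator (P x) * count Q ys + count P xs * count Q ys
  ≡⟨ *-distribʳ-+ (count Q ys) (indicator (P x)) (count P xs) ⟨
    (indicator (P x) + count P xs) * count Q ys ∎
  where
  open ≡-Reasoning
  PQ = λ z → P (proj₁ z) ∧ Q (proj₂ z)
  row : ∀ ys → count (λ y → P x ∧ Q y) ys ≡ indicator (P x) * count Q ys
  row []       = sym (*-zeroʳ (indicator (P x)))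
  row (y ∷ ys) = trans (cong₂ _+_ (indicator-∧ (P x) (Q y)) (row ys))
                       (sym (*-distribˡ-+ (indicator (P x)) (indicator (Q y)) (count Q ys)))

sum-map-cong : {f g : A → ℕ} (xs : List A) → (∀ x → x ∈ xs → f x ≡ g x) →
               sum (map f xs) ≡ sum (map g xs)
sum-map-cong []       f≗g = refl
sum-map-cong (x ∷ xs) f≗g = cong₂ _+_ (f≗g x (here refl)) (sum-map-cong xs (λ y → f≗g y ∘ there))

sum-map-zero : (xs : List A) → sum (map (λ _ → 0) xs) ≡ 0
sum-map-zero []       = refl
sum-map-zero (_ ∷ xs) = sum-map-zero xs

sum-map-+ : (f g : A → ℕ) (xs : List A) →
            sum (map (λ x → f x + g x) xs) ≡ sum (map f xs) + sum (map g xs)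
sum-map-+ f g []       = refl
sum-map-+ f g (x ∷ xs) = trans (cong (f x + g x +_) (sum-map-+ f g xs))
                               (interchange (f x) (g x) (sum (map f xs)) (sum (map g xs)))

sum-map-*ˡ : (q : ℕ) (f : A → ℕ) (xs : List A) → sum (map (λ x → q * f x) xs) ≡ q * sum (map f xs)
sum-map-*ˡ q f []       = sym (*-zeroʳ q)
sum-map-*ˡ q f (x ∷ xs) = trans (cong (q * f x +_) (sum-map-*ˡ q f xs)) (sym (*-distribˡ-+ q (f x) _))

sum-indicator-≡ᵇ : {u : ℕ} {vs : List ℕ} → Unique vs → u ∈ vs →
                   sum (map (λ v → indicator (u ≡ᵇ v)) vs) ≡ 1
sum-indicator-≡ᵇ {u} {v ∷ vs} (v∉vs ∷ _) (here refl)
  rewrite Equivalence.to T-≡ (≡⇒≡ᵇ u u refl) =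
  cong suc (trans (sum-map-cong vs elsewhere) (sum-map-zero vs))
  where
  elsewhere : ∀ w → w ∈ vs → indicator (u ≡ᵇ w) ≡ 0
  elsewhere w w∈ with u ≡ᵇ w in eq
  ... | false = refl
  ... | true  = ⊥-elim (All.lookup v∉vs w∈ (≡ᵇ⇒≡ u w (subst T (sym eq) _)))
sum-indicator-≡ᵇ {u} {v ∷ vs} (v∉vs ∷ vs-unique) (there u∈) with u ≡ᵇ v in eq
... | false = sum-indicator-≡ᵇ vs-unique u∈
... | true  = ⊥-elim (All.lookup v∉vs u∈ (sym (≡ᵇ⇒≡ u v (subst T (sym eq) _))))

count-fibres : (P : A → Bool) (g : A → ℕ) {vs : List ℕ} → Unique vs → (∀ x → T (P x) → g x ∈ vs) →
  (xs : List A) → count P xs ≡ sum (map (λ v → count (λ x → P x ∧ (g x ≡ᵇ v)) xs) vs)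
count-fibres P g {vs} vs-unique g∈vs [] = sym (sum-map-zero vs)
count-fibres P g {vs} vs-unique g∈vs (x ∷ xs) = begin
    indicator (P x) + count P xs
  ≡⟨ cong₂ _+_ head (count-fibres P g vs-unique g∈vs xs) ⟩
    sum (map (λ v → indicator (P x ∧ (g x ≡ᵇ v))) vs)
      + sum (map (λ v → count (λ x → P x ∧ (g x ≡ᵇ v)) xs) vs)
  ≡⟨ sum-map-+ _ _ vs ⟨
    sum (map (λ v → count (λ x → P x ∧ (g x ≡ᵇ v)) (x ∷ xs)) vs) ∎
  where
  open ≡-Reasoning
  head : indicator (P x) ≡ sum (map (λ v → indicator (P x ∧ (g x ≡ᵇ v))) vs)
  head with P x in eq
  ... | true  = sym (sum-indicator-≡ᵇ vs-unique (g∈vs x (subst T (sym eq) _)))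
  ... | false = sym (sum-map-zero vs)

map⁺-injectiveOn : (f : A → B) {xs : List A} → Unique xs →
  (∀ {x y} → x ∈ xs → y ∈ xs → f x ≡ f y → x ≡ y) → Unique (map f xs)
map⁺-injectiveOn f {[]}     _               _   = []
map⁺-injectiveOn f {x ∷ xs} (x∉xs ∷ unique) inj =
  All.map⁺ (All.tabulate λ y∈ fx≡fy → All.lookup x∉xs y∈ (inj (here refl) (there y∈) fx≡fy))
  ∷ map⁺-injectiveOn f unique (λ x∈ y∈ → inj (there x∈) (there y∈))

Enumerates : List A → Set _
Enumerates {A = A} xs = Unique xs × (∀ (x : A) → x ∈ xs)

count-bijection : {xs : List A} {ys : List B} → Enumerates xs → Enumerates ys →
  (P : A → Bool) (Q : B → Bool) (f : A → B) (g : B → A) →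
  (∀ x → T (P x) → T (Q (f x))) → (∀ y → T (Q y) → T (P (g y))) →
  (∀ x → T (P x) → g (f x) ≡ x) → (∀ y → T (Q y) → f (g y) ≡ y) →
  count P xs ≡ count Q ys
count-bijection {xs = xs} {ys} (xs-unique , xs-complete) (ys-unique , ys-complete)
                P Q f g P⇒Qf Q⇒Pg gf≗id fg≗id = begin
    count P xs                    ≡⟨ length-filter (T? ∘ P) xs ⟨
    length Ps                     ≡⟨ length-map f Ps ⟨
    length (map f Ps)             ≡⟨ ↭-length (∼bag⇒↭ (unique∧set⇒bag fPs-unique Qs-unique same)) ⟩
    length Qs                     ≡⟨ length-filter (T? ∘ Q) ys ⟩
    count Q ys                    ∎
  where
  open ≡-Reasoning
  Ps = filter (T? ∘ P) xs
  Qs = filter (T? ∘ Q) ys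
  P-of : ∀ {x} → x ∈ Ps → T (P x)
  P-of = proj₂ ∘ ∈-filter⁻ (T? ∘ P) {xs = xs}
  Q-of : ∀ {y} → y ∈ Qs → T (Q y)
  Q-of = proj₂ ∘ ∈-filter⁻ (T? ∘ Q) {xs = ys}
  Qs-unique : Unique Qs
  Qs-unique = Unique.filter⁺ (T? ∘ Q) ys-unique
  fPs-unique : Unique (map f Ps)
  fPs-unique = map⁺-injectiveOn f (Unique.filter⁺ (T? ∘ P) xs-unique)
    λ x∈ x′∈ fx≡fx′ → trans (sym (gf≗id _ (P-of x∈)))
                             (trans (cong g fx≡fx′) (gf≗id _ (P-of x′∈)))
  same : ∀ {y} → y ∈ map f Ps ⇔ y ∈ Qs
  same = mk⇔ to from
    where
    to : ∀ {y} → y ∈ map f Ps → y ∈ Qs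
    to y∈ with x , x∈ , refl ← ∈-map⁻ f y∈ =
      ∈-filter⁺ (T? ∘ Q) (ys-complete (f x)) (P⇒Qf x (P-of x∈))
    from : ∀ {y} → y ∈ Qs → y ∈ map f Ps
    from {y} y∈ = subst (_∈ map f Ps) (fg≗id y (Q-of y∈))
                        (∈-map⁺ f (∈-filter⁺ (T? ∘ P) (xs-complete (g y)) (Q⇒Pg y (Q-of y∈))))

count-tabulate : ∀ {n} (P : A → Bool) (f : Fin n → A) → count P (tabulate f) ≡ count (P ∘ f) (allFin n)
count-tabulate {n = n} P f = trans (cong (count P) (sym (map-tabulate id f))) (count-map P f (allFin n))

count-allFin-↑ : ∀ p {m} (P : Fin (p + m) → Bool) →
  count P (allFin (p + m)) ≡ count (P ∘ (_↑ˡ m)) (allFin p) + count (P ∘ (p ↑ʳ_)) (allFin m)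
count-allFin-↑ zero    P = refl
count-allFin-↑ (suc p) {m} P = begin
    indicator (P zero) + count P (tabulate suc)
  ≡⟨ cong (indicator (P zero) +_) (trans (count-tabulate P suc) (count-allFin-↑ p (P ∘ suc))) ⟩
    indicator (P zero) + (count (P ∘ suc ∘ (_↑ˡ m)) (allFin p) + count (P ∘ (suc p ↑ʳ_)) (allFin m))
  ≡⟨ +-assoc (indicator (P zero)) _ _ ⟨
    indicator (P zero) + count (P ∘ suc ∘ (_↑ˡ m)) (allFin p) + count (P ∘ (suc p ↑ʳ_)) (allFin m)
  ≡⟨ cong (λ k → indicator (P zero) + k + count (P ∘ (suc p ↑ʳ_)) (allFin m))
          (count-tabulate (P ∘ (_↑ˡ m)) suc) ⟨
    count (P ∘ (_↑ˡ m)) (allFin (suc p)) + count (P ∘ (suc p ↑ʳ_)) (allFin m) ∎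
  where open ≡-Reasoning

count-allFin-suc : ∀ n (P : Fin (suc n) → Bool) →
  count P (allFin (suc n)) ≡ count (P ∘ inject₁) (allFin n) + indicator (P (fromℕ n))
count-allFin-suc zero    P = +-comm (indicator (P zero)) 0
count-allFin-suc (suc n) P = begin
    indicator (P zero) + count P (tabulate suc)
  ≡⟨ cong (indicator (P zero) +_) (trans (count-tabulate P suc) (count-allFin-suc n (P ∘ suc))) ⟩
    indicator (P zero) + (count (P ∘ suc ∘ inject₁) (allFin n) + indicator (P (fromℕ (suc n))))
  ≡⟨ +-assoc (indicator (P zero)) _ _ ⟨
    indicator (P zero) + count (P ∘ suc ∘ inject₁) (allFin n) + indicator (P (fromℕ (suc n)))
  ≡⟨ cong (λ k → indicator (P zero) + k + indicator (P (fromℕ (suc n))))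
          (count-tabulate (P ∘ inject₁) suc) ⟨
    count (P ∘ inject₁) (allFin (suc n)) + indicator (P (fromℕ (suc n))) ∎
  where open ≡-Reasoning

count-false : (xs : List A) → count (λ _ → false) xs ≡ 0
count-false []       = refl
count-false (_ ∷ xs) = count-false xs

count-toℕ< : ∀ n p → p ≤ n → count (λ (x : Fin n) → toℕ x <ᵇ p) (allFin n) ≡ p
count-toℕ< n       zero    _         = count-false (allFin n)
count-toℕ< (suc n) (suc p) (s≤s p≤n) =
  cong suc (trans (count-tabulate {n = n} (λ x → toℕ x <ᵇ suc p) suc) (count-toℕ< n p p≤n))

concatMap-map≡cartesianProductWith : (f : A → B → C) (xs : List A) (ys : List B) →
  concatMap (λ x → map (f x) ys) xs ≡ cartesianProductWith f xs ys
concatMap-map≡cartesianProductWith f []       ys = refl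
concatMap-map≡cartesianProductWith f (x ∷ xs) ys =
  cong (map (f x) ys ++_) (concatMap-map≡cartesianProductWith f xs ys)

allFin-enumerates : ∀ n → Enumerates (allFin n)
allFin-enumerates n = Unique.allFin⁺ n , ∈-allFin

allVecs-enumerates : ∀ n m → Enumerates (allVecs n m)
allVecs-enumerates n zero = ([] ∷ []) , λ { []ᵛ → here refl }
allVecs-enumerates n (suc m)
  rewrite concatMap-map≡cartesianProductWith _∷ᵛ_ (allFin n) (allVecs n m) =
  let unique , complete = allVecs-enumerates n m in
  Unique.cartesianProductWith⁺ _∷ᵛ_ Vec.∷-injective (Unique.allFin⁺ n) unique ,
  λ { (x ∷ᵛ v) → ∈-cartesianProductWith⁺ _∷ᵛ_ (∈-allFin x) (complete v) }

cartesianProduct-enumerates : {xs : List A} {ys : List B} →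
  Enumerates xs → Enumerates ys → Enumerates (cartesianProduct xs ys)
cartesianProduct-enumerates (xs-unique , xs-complete) (ys-unique , ys-complete) =
  Unique.cartesianProduct⁺ xs-unique ys-unique ,
  λ { (x , y) → ∈-cartesianProduct⁺ (xs-complete x) (ys-complete y) }

T-not-∨ : ∀ x y → T (not x ∨ y) ⇔ (T x → T y)
T-not-∨ true  y = mk⇔ (λ y _ → y) (λ f → f _)
T-not-∨ false y = mk⇔ (λ _ ()) (λ _ → _)

T⇔T⇒≡ : ∀ {x y} → (T x → T y) → (T y → T x) → x ≡ y
T⇔T⇒≡ {false} {false} _ _ = refl
T⇔T⇒≡ {false} {true}  _ g = ⊥-elim (g _)
T⇔T⇒≡ {true}  {false} f _ = ⊥-elim (f _)
T⇔T⇒≡ {true}  {true}  _ _ = refl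

≡ᵇ⇔≡ : ∀ {m n} → T (m ≡ᵇ n) ⇔ m ≡ n
≡ᵇ⇔≡ {m} {n} = mk⇔ (≡ᵇ⇒≡ m n) (≡⇒≡ᵇ m n)

¬<ᵇ⇒≥ : ∀ {m n} → T (not (m <ᵇ n)) → n ≤ m
¬<ᵇ⇒≥ {m} {n} ¬m<ᵇn = ≮⇒≥ λ m<n → subst T (Equivalence.to T-not-≡ ¬m<ᵇn) (<⇒<ᵇ m<n)

≥⇒¬<ᵇ : ∀ {m n} → n ≤ m → T (not (m <ᵇ n))
≥⇒¬<ᵇ {m} {n} n≤m with m <ᵇ n in eq
... | false = _
... | true  = ≤⇒≯ n≤m (<ᵇ⇒< m n (subst T (sym eq) _))

all-allFin : ∀ {n} (P : Fin n → Bool) → T (all P (allFin n)) ⇔ (∀ i → T (P i))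
all-allFin {n} P = mk⇔ (λ t i → All.lookup (All.all⁺ P (allFin n) t) (∈-allFin i))
                       (λ f → All.all⁻ P {xs = allFin n} (All.tabulate λ {i} _ → f i))

∈-interval : ∀ {t n} → t ∈ interval 1 n ⇔ (1 ≤ t × t ≤ n)
∈-interval {t} {n} = mk⇔ to from
  where
  to : t ∈ interval 1 n → 1 ≤ t × t ≤ n
  to t∈ with t′ , t′∈ , refl ← ∈-map⁻ suc t∈ = s≤s z≤n , ∈-upTo⁻ t′∈
  from : 1 ≤ t × t ≤ n → t ∈ interval 1 n
  from (s≤s _ , t≤n) = ∈-map⁺ suc (∈-upTo⁺ t≤n)

interval-unique : ∀ n → Unique (interval 1 n)
interval-unique n = Unique.map⁺ suc-injective (Unique.upTo⁺ n)

sumFT-suc : ∀ n f → sumFT 1 (suc n) f ≡ sumFT 1 n f + f (suc n)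
sumFT-suc n f = begin
  sum (map f (map suc (upTo (suc n))))          ≡⟨ cong (sum ∘ map f ∘ map suc) (applyUpTo-∷ʳ id n) ⟨
  sum (map f (map suc (upTo n ++ [ n ])))       ≡⟨ cong (sum ∘ map f) (map-++ suc (upTo n) [ n ]) ⟩
  sum (map f (map suc (upTo n) ++ [ suc n ]))   ≡⟨ cong sum (map-++ f (map suc (upTo n)) [ suc n ]) ⟩
  sum (map f (map suc (upTo n)) ++ [ f (suc n) ]) ≡⟨ sum-++ (map f (map suc (upTo n))) [ f (suc n) ] ⟩
  sumFT 1 n f + (f (suc n) + 0)                 ≡⟨ cong (sumFT 1 n f +_) (+-identityʳ (f (suc n))) ⟩
  sumFT 1 n f + f (suc n)                       ∎
  where open ≡-Reasoning

-- Permutations, orbits and cycle minima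

lookup-ext : ∀ {n} {u v : Vec A n} → (∀ i → lookup u i ≡ lookup v i) → u ≡ v
lookup-ext {u = u} {v} u≗v =
  trans (sym (Vec.tabulate∘lookup u)) (trans (Vec.tabulate-cong u≗v) (Vec.tabulate∘lookup v))

-- A missed y would give an injection Fin (suc n) → Fin n by punching y out.
injective⇒surjective : ∀ {n} {f : Fin n → Fin n} → Injective _≡_ _≡_ f → ∀ y → ∃ λ x → f x ≡ y
injective⇒surjective {n} {f} inj y with Fin.any? (λ x → f x Fin.≟ y)
... | yes hit = hit
injective⇒surjective {suc n} {f} inj y | no miss = ⊥-elim (<-irrefl refl (Fin.injective⇒≤ squeezed-injective))
  where
  f≢y : ∀ x → y ≢ f x
  f≢y x y≡fx = miss (x , sym y≡fx)
  squeezed-injective : Injective _≡_ _≡_ (λ x → punchOut (f≢y x))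
  squeezed-injective eq = inj (Fin.punchOut-injective (f≢y _) (f≢y _) eq)

Endo : ℕ → Set
Endo n = Vec (Fin n) n

IsPermutation : ∀ {n} → Endo n → Set
IsPermutation σ = Injective _≡_ _≡_ (lookup σ)

isPerm⇔IsPermutation : ∀ {n} (σ : Endo n) → T (isPerm σ) ⇔ IsPermutation σ
isPerm⇔IsPermutation {n} σ = mk⇔ to from
  where
  distinct : Fin n → Fin n → Bool
  distinct i j = not ⌊ lookup σ i Fin.≟ lookup σ j ⌋ ∨ ⌊ i Fin.≟ j ⌋
  implication : ∀ i j → T (distinct i j) ⇔ (lookup σ i ≡ lookup σ j → i ≡ j)
  implication i j = ⇔-trans (T-not-∨ ⌊ lookup σ i Fin.≟ lookup σ j ⌋ ⌊ i Fin.≟ j ⌋)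
                            (mk⇔ (λ f → toWitness ∘ f ∘ fromWitness) (λ f → fromWitness ∘ f ∘ toWitness))
  to : T (isPerm σ) → IsPermutation σ
  to t {i} {j} = Equivalence.to (implication i j)
    (Equivalence.to (all-allFin (distinct i)) (Equivalence.to (all-allFin _) t i) j)
  from : IsPermutation σ → T (isPerm σ)
  from inj = Equivalence.from (all-allFin _) λ i → Equivalence.from (all-allFin (distinct i)) λ j →
    Equivalence.from (implication i j) inj

iter-+ : ∀ {n} (σ : Endo n) t d i → iter σ (t + d) i ≡ iter σ t (iter σ d i)
iter-+ σ zero    d i = refl
iter-+ σ (suc t) d i = cong (lookup σ) (iter-+ σ t d i)

iter-injective : ∀ {n} {σ : Endo n} → IsPermutation σ → ∀ t {i j} → iter σ t i ≡ iter σ t j → i ≡ j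
iter-injective inj zero    eq = eq
iter-injective inj (suc t) eq = iter-injective inj t (inj eq)

iter-period : ∀ {n} {σ : Endo n} → IsPermutation σ → ∀ i → ∃ λ a → 1 ≤ a × a ≤ n × iter σ a i ≡ i
iter-period {n} {σ} inj i
  with t₁ , t₂ , t₁<t₂ , eq ← Fin.pigeonhole (n<1+n n) (λ t → iter σ (toℕ t) i) =
  a , m<n⇒0<n∸m t₁<t₂ , a≤n , iter-injective inj (toℕ t₁) shifted
  where
  a = toℕ t₂ ∸ toℕ t₁
  a≤n : a ≤ n
  a≤n = ≤-trans (m∸n≤m (toℕ t₂) (toℕ t₁)) (s≤s⁻¹ (Fin.toℕ<n t₂))
  shifted : iter σ (toℕ t₁) (iter σ a i) ≡ iter σ (toℕ t₁) i
  shifted = begin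
    iter σ (toℕ t₁) (iter σ a i) ≡⟨ iter-+ σ (toℕ t₁) a i ⟨
    iter σ (toℕ t₁ + a) i        ≡⟨ cong (λ t → iter σ t i) (m+[n∸m]≡n (<⇒≤ t₁<t₂)) ⟩
    iter σ (toℕ t₂) i            ≡⟨ eq ⟨
    iter σ (toℕ t₁) i            ∎
    where open ≡-Reasoning

orbit-bounded : ∀ {n} {σ : Endo n} → IsPermutation σ →
                ∀ i t → ∃ λ t′ → t′ ≤ n × iter σ t i ≡ iter σ t′ i
orbit-bounded {n} {σ} inj i = <-rec _ step
  where
  step : ∀ t → (∀ {u} → u < t → ∃ λ t′ → t′ ≤ n × iter σ u i ≡ iter σ t′ i) →
         ∃ λ t′ → t′ ≤ n × iter σ t i ≡ iter σ t′ i
  step t rec with t ≤? n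
  ... | yes t≤n = t , t≤n , refl
  ... | no t≰n with a , 1≤a , a≤n , σᵃi≡i ← iter-period inj i =
    map₂ (map₂ (trans unwind)) (rec (∸-monoʳ-< 1≤a a≤t))
    where
    a≤t : a ≤ t
    a≤t = ≤-trans a≤n (<⇒≤ (≰⇒> t≰n))
    unwind : iter σ t i ≡ iter σ (t ∸ a) i
    unwind = begin
      iter σ t i                  ≡⟨ cong (λ u → iter σ u i) (m∸n+n≡m a≤t) ⟨
      iter σ (t ∸ a + a) i        ≡⟨ iter-+ σ (t ∸ a) a i ⟩
      iter σ (t ∸ a) (iter σ a i) ≡⟨ cong (iter σ (t ∸ a)) σᵃi≡i ⟩
      iter σ (t ∸ a) i            ∎
      where open ≡-Reasoning

CycleMin : ∀ {n} → Endo n → Fin n → Set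
CycleMin σ i = ∀ t → toℕ i ≤ toℕ (iter σ t i)

CycleMin⇒isCycleMin : ∀ {n} {σ : Endo n} {i} → CycleMin σ i → T (isCycleMin σ i)
CycleMin⇒isCycleMin {n} min = All.all⁻ _ {xs = interval 1 n} (All.tabulate λ {t} _ → ≥⇒¬<ᵇ (min t))

-- The Boolean test only inspects σ¹ i, …, σⁿ i; injectivity makes the orbit periodic.
isCycleMin⇒CycleMin : ∀ {n} {σ : Endo n} → IsPermutation σ → ∀ {i} → T (isCycleMin σ i) → CycleMin σ i
isCycleMin⇒CycleMin {n} {σ} inj {i} test t with orbit-bounded inj i t
... | zero     , _     , eq = ≤-reflexive (cong toℕ (sym eq))
... | suc t′ , t′≤n , eq = subst (λ j → toℕ i ≤ toℕ j) (sym eq)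
  (¬<ᵇ⇒≥ (All.lookup (All.all⁺ _ (interval 1 n) test) (Equivalence.from ∈-interval (s≤s z≤n , t′≤n))))

isCycleMin-≡ : ∀ {n m} {σ : Endo n} {τ : Endo m} → IsPermutation σ → IsPermutation τ →
  ∀ {i j} → (CycleMin σ i → CycleMin τ j) → (CycleMin τ j → CycleMin σ i) →
  isCycleMin σ i ≡ isCycleMin τ j
isCycleMin-≡ σ-perm τ-perm to from =
  T⇔T⇒≡ (CycleMin⇒isCycleMin ∘ to ∘ isCycleMin⇒CycleMin σ-perm)
        (CycleMin⇒isCycleMin ∘ from ∘ isCycleMin⇒CycleMin τ-perm)

numCycles≡count : ∀ {n} (σ : Endo n) → numCycles σ ≡ count (isCycleMin σ) (allFin n)
numCycles≡count {n} σ = length-filter (T? ∘ isCycleMin σ) (allFin n)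

numCycles≤n : ∀ {n} (σ : Endo n) → numCycles σ ≤ n
numCycles≤n {n} σ = begin
  numCycles σ                         ≡⟨ numCycles≡count σ ⟩
  count (isCycleMin σ) (allFin n)     ≤⟨ count≤length (isCycleMin σ) (allFin n) ⟩
  length (allFin n)                   ≡⟨ length-tabulate id ⟩
  n                                   ∎
  where open ≤-Reasoning

numCycles-pos : ∀ {n} (σ : Endo (suc n)) → 0 < numCycles σ
numCycles-pos σ = subst (0 <_) (sym (numCycles≡count σ))
  (count-pos (isCycleMin σ) (∈-allFin zero) (CycleMin⇒isCycleMin {σ = σ} λ _ → z≤n))

-- Closed prefixes and the first block

Closed : ∀ {n} → Endo n → ℕ → Set
Closed σ p = ∀ i → toℕ i < p → toℕ (lookup σ i) < p

closed : ∀ {n} → Endo n → ℕ → Bool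
closed {n} σ p = all (λ i → not (toℕ i <ᵇ p) ∨ (toℕ (lookup σ i) <ᵇ p)) (allFin n)

closed⇔Closed : ∀ {n} (σ : Endo n) p → T (closed σ p) ⇔ Closed σ p
closed⇔Closed σ p = mk⇔
  (λ t i i<p → <ᵇ⇒< _ p (Equivalence.to (T-not-∨ (toℕ i <ᵇ p) _)
                                         (Equivalence.to (all-allFin _) t i) (<⇒<ᵇ i<p)))
  (λ cl → Equivalence.from (all-allFin _) λ i →
     Equivalence.from (T-not-∨ (toℕ i <ᵇ p) _) (<⇒<ᵇ ∘ cl i ∘ <ᵇ⇒< _ p))

Closed-n : ∀ {n} (σ : Endo n) → Closed σ n
Closed-n σ i _ = Fin.toℕ<n (lookup σ i)

Indecomposable : ∀ {n} → Endo n → Set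
Indecomposable {n} σ = ∀ q → 1 ≤ q → q < n → ¬ Closed σ q

isIndecomposable⇔Indecomposable : ∀ {n} (σ : Endo (suc n)) → T (isIndecomposable σ) ⇔ Indecomposable σ
isIndecomposable⇔Indecomposable {n} σ = mk⇔ to from
  where
  to : T (isIndecomposable σ) → Indecomposable σ
  to t q 1≤q q<n cl = subst T (Equivalence.to T-not-≡ t) (Any.any⁺ (closed σ)
    (lose (Equivalence.from ∈-interval (1≤q , s≤s⁻¹ q<n)) (Equivalence.from (closed⇔Closed σ q) cl)))
  from : Indecomposable σ → T (isIndecomposable σ)
  from indec with isDecomposable σ in eq
  ... | false = _
  ... | true with q , q∈ , cl ← find (Any.any⁻ (closed σ) (interval 1 n) (subst T (sym eq) _))
    with 1≤q , q≤n ← Equivalence.to ∈-interval q∈ =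
    indec q 1≤q (s≤s q≤n) (Equivalence.to (closed⇔Closed σ q) cl)

firstFrom : (ℕ → Bool) → ℕ → ℕ → ℕ
firstFrom P q zero    = q
firstFrom P q (suc f) = if P q then q else firstFrom P (suc q) f

firstFrom-≥ : ∀ P q f → q ≤ firstFrom P q f
firstFrom-≥ P q zero    = ≤-refl
firstFrom-≥ P q (suc f) with P q
... | true  = ≤-refl
... | false = ≤-trans (n≤1+n q) (firstFrom-≥ P (suc q) f)

firstFrom-≤ : ∀ P q f → firstFrom P q f ≤ q + f
firstFrom-≤ P q zero    = ≤-reflexive (sym (+-identityʳ q))
firstFrom-≤ P q (suc f) with P q
... | true  = m≤m+n q (suc f)
... | false = ≤-trans (firstFrom-≤ P (suc q) f) (≤-reflexive (sym (+-suc q f)))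

firstFrom-minimal : ∀ P q f {r} → q ≤ r → r < firstFrom P q f → ¬ T (P r)
firstFrom-minimal P q zero    q≤r r<q = ⊥-elim (≤⇒≯ q≤r r<q)
firstFrom-minimal P q (suc f) q≤r r<  with P q in eq
... | true  = ⊥-elim (≤⇒≯ q≤r r<)
... | false with m≤n⇒m<n∨m≡n q≤r
...   | inj₁ q<r  = firstFrom-minimal P (suc q) f q<r r<
...   | inj₂ refl = subst T eq

firstFrom-found : ∀ P q f → T (P (firstFrom P q f)) ⊎ firstFrom P q f ≡ q + f
firstFrom-found P q zero    = inj₂ (sym (+-identityʳ q))
firstFrom-found P q (suc f) with P q in eq
... | true  = inj₁ (subst T (sym eq) _)
... | false with firstFrom-found P (suc q) f
...   | inj₁ found = inj₁ found
...   | inj₂ end   = inj₂ (trans end (sym (+-suc q f)))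

firstBlock : ∀ {n} → Endo n → ℕ
firstBlock {n} σ = firstFrom (closed σ) 1 (n ∸ 1)

module _ {n} (σ : Endo (suc n)) where

  firstBlock-pos : 1 ≤ firstBlock σ
  firstBlock-pos = firstFrom-≥ (closed σ) 1 n

  firstBlock≤n : firstBlock σ ≤ suc n
  firstBlock≤n = firstFrom-≤ (closed σ) 1 n

  firstBlock-closed : Closed σ (firstBlock σ)
  firstBlock-closed with firstFrom-found (closed σ) 1 n
  ... | inj₁ found = Equivalence.to (closed⇔Closed σ _) found
  ... | inj₂ end   = subst (Closed σ) (sym end) (Closed-n σ)

  firstBlock-minimal : ∀ q → 1 ≤ q → q < firstBlock σ → ¬ Closed σ q
  firstBlock-minimal q 1≤q q<fb =
    firstFrom-minimal (closed σ) 1 n 1≤q q<fb ∘ Equivalence.from (closed⇔Closed σ q)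

  firstBlock-unique : ∀ p → 1 ≤ p → Closed σ p → (∀ q → 1 ≤ q → q < p → ¬ Closed σ q) →
                      firstBlock σ ≡ p
  firstBlock-unique p 1≤p p-closed p-minimal with <-cmp (firstBlock σ) p
  ... | tri< fb<p _ _ = ⊥-elim (p-minimal (firstBlock σ) firstBlock-pos fb<p firstBlock-closed)
  ... | tri≈ _ fb≡p _ = fb≡p
  ... | tri> _ _ p<fb = ⊥-elim (firstBlock-minimal p 1≤p p<fb p-closed)

  isIndecomposable≡firstBlock≡ᵇn : isIndecomposable σ ≡ (firstBlock σ ≡ᵇ suc n)
  isIndecomposable≡firstBlock≡ᵇn = T⇔T⇒≡ to from
    where
    to : T (isIndecomposable σ) → T (firstBlock σ ≡ᵇ suc n)
    to t with m≤n⇒m<n∨m≡n firstBlock≤n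
    ... | inj₁ fb<n = ⊥-elim (Equivalence.to (isIndecomposable⇔Indecomposable σ) t
                                _ firstBlock-pos fb<n firstBlock-closed)
    ... | inj₂ fb≡n = ≡⇒≡ᵇ _ _ fb≡n
    from : T (firstBlock σ ≡ᵇ suc n) → T (isIndecomposable σ)
    from fb≡ᵇn = Equivalence.from (isIndecomposable⇔Indecomposable σ) λ q 1≤q q<n →
      firstBlock-minimal q 1≤q (subst (q <_) (sym (≡ᵇ⇒≡ _ _ fb≡ᵇn)) q<n)

-- Direct sums

module _ {p m : ℕ} where

  data SplitView : Fin (p + m) → Set where
    left  : (x : Fin p) → SplitView (x ↑ˡ m)
    right : (y : Fin m) → SplitView (p ↑ʳ y)

  splitView : ∀ z → SplitView z
  splitView z with splitAt p z in eq
  ... | inj₁ x = subst SplitView (Fin.splitAt⁻¹-↑ˡ eq) (left x)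
  ... | inj₂ y = subst SplitView (Fin.splitAt⁻¹-↑ʳ eq) (right y)

  toℕ-↑ˡ< : ∀ (x : Fin p) → toℕ (x ↑ˡ m) < p
  toℕ-↑ˡ< x = subst (_< p) (sym (Fin.toℕ-↑ˡ x m)) (Fin.toℕ<n x)

  ≤-toℕ-↑ʳ : ∀ (y : Fin m) → p ≤ toℕ (p ↑ʳ y)
  ≤-toℕ-↑ʳ y = subst (p ≤_) (sym (Fin.toℕ-↑ʳ p y)) (m≤m+n p (toℕ y))

  ↑ˡ≢↑ʳ : ∀ (x : Fin p) (y : Fin m) → x ↑ˡ m ≢ p ↑ʳ y
  ↑ˡ≢↑ʳ x y eq = <⇒≱ (toℕ-↑ˡ< x) (subst (λ z → p ≤ toℕ z) (sym eq) (≤-toℕ-↑ʳ y))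

  ⊕-entry : Endo p → Endo m → Fin (p + m) → Fin (p + m)
  ⊕-entry τ ρ z = [ (λ x → lookup τ x ↑ˡ m) , (λ y → p ↑ʳ lookup ρ y) ]′ (splitAt p z)

  _⊕_ : Endo p → Endo m → Endo (p + m)
  τ ⊕ ρ = tabulateᵛ (⊕-entry τ ρ)

  module _ (τ : Endo p) (ρ : Endo m) where

    lookup-⊕ˡ : ∀ x → lookup (τ ⊕ ρ) (x ↑ˡ m) ≡ lookup τ x ↑ˡ m
    lookup-⊕ˡ x rewrite Vec.lookup∘tabulate (⊕-entry τ ρ) (x ↑ˡ m) | Fin.splitAt-↑ˡ p x m = refl

    lookup-⊕ʳ : ∀ y → lookup (τ ⊕ ρ) (p ↑ʳ y) ≡ p ↑ʳ lookup ρ y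
    lookup-⊕ʳ y rewrite Vec.lookup∘tabulate (⊕-entry τ ρ) (p ↑ʳ y) | Fin.splitAt-↑ʳ p m y = refl

    ⊕-permutation : IsPermutation τ → IsPermutation ρ → IsPermutation (τ ⊕ ρ)
    ⊕-permutation τ-perm ρ-perm {i} {j} eq with splitView i | splitView j
    ... | left x  | left x′  = cong (_↑ˡ m) (τ-perm (Fin.↑ˡ-injective m _ _
                                 (trans (sym (lookup-⊕ˡ x)) (trans eq (lookup-⊕ˡ x′)))))
    ... | left x  | right y  = ⊥-elim (↑ˡ≢↑ʳ _ _ (trans (sym (lookup-⊕ˡ x)) (trans eq (lookup-⊕ʳ y))))
    ... | right y | left x   = ⊥-elim (↑ˡ≢↑ʳ _ _ (trans (sym (lookup-⊕ˡ x)) (trans (sym eq) (lookup-⊕ʳ y))))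
    ... | right y | right y′ = cong (p ↑ʳ_) (ρ-perm (Fin.↑ʳ-injective p _ _
                                 (trans (sym (lookup-⊕ʳ y)) (trans eq (lookup-⊕ʳ y′)))))

    ⊕-permutation⁻ : IsPermutation (τ ⊕ ρ) → IsPermutation τ × IsPermutation ρ
    ⊕-permutation⁻ perm =
      (λ {x} {x′} eq → Fin.↑ˡ-injective m _ _
         (perm (trans (lookup-⊕ˡ x) (trans (cong (_↑ˡ m) eq) (sym (lookup-⊕ˡ x′)))))) ,
      (λ {y} {y′} eq → Fin.↑ʳ-injective p _ _
         (perm (trans (lookup-⊕ʳ y) (trans (cong (p ↑ʳ_) eq) (sym (lookup-⊕ʳ y′))))))

    iter-⊕ˡ : ∀ t x → iter (τ ⊕ ρ) t (x ↑ˡ m) ≡ iter τ t x ↑ˡ m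
    iter-⊕ˡ zero    x = refl
    iter-⊕ˡ (suc t) x = trans (cong (lookup (τ ⊕ ρ)) (iter-⊕ˡ t x)) (lookup-⊕ˡ _)

    iter-⊕ʳ : ∀ t y → iter (τ ⊕ ρ) t (p ↑ʳ y) ≡ p ↑ʳ iter ρ t y
    iter-⊕ʳ zero    y = refl
    iter-⊕ʳ (suc t) y = trans (cong (lookup (τ ⊕ ρ)) (iter-⊕ʳ t y)) (lookup-⊕ʳ _)

    numCycles-⊕ : IsPermutation τ → IsPermutation ρ → numCycles (τ ⊕ ρ) ≡ numCycles τ + numCycles ρ
    numCycles-⊕ τ-perm ρ-perm = begin
        numCycles (τ ⊕ ρ)
      ≡⟨ numCycles≡count (τ ⊕ ρ) ⟩
        count (isCycleMin (τ ⊕ ρ)) (allFin (p + m))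
      ≡⟨ count-allFin-↑ p (isCycleMin (τ ⊕ ρ)) ⟩
        count (isCycleMin (τ ⊕ ρ) ∘ (_↑ˡ m)) (allFin p)
          + count (isCycleMin (τ ⊕ ρ) ∘ (p ↑ʳ_)) (allFin m)
      ≡⟨ cong₂ _+_ (count-cong (allFin p) cycleMin-⊕ˡ) (count-cong (allFin m) cycleMin-⊕ʳ) ⟩
        count (isCycleMin τ) (allFin p) + count (isCycleMin ρ) (allFin m)
      ≡⟨ cong₂ _+_ (numCycles≡count τ) (numCycles≡count ρ) ⟨
        numCycles τ + numCycles ρ ∎
      where
      open ≡-Reasoning
      σ-perm = ⊕-permutation τ-perm ρ-perm
      toℕ-iter-⊕ˡ : ∀ t x → toℕ (iter (τ ⊕ ρ) t (x ↑ˡ m)) ≡ toℕ (iter τ t x)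
      toℕ-iter-⊕ˡ t x = trans (cong toℕ (iter-⊕ˡ t x)) (Fin.toℕ-↑ˡ _ m)
      toℕ-iter-⊕ʳ : ∀ t y → toℕ (iter (τ ⊕ ρ) t (p ↑ʳ y)) ≡ p + toℕ (iter ρ t y)
      toℕ-iter-⊕ʳ t y = trans (cong toℕ (iter-⊕ʳ t y)) (Fin.toℕ-↑ʳ p _)
      cycleMin-⊕ˡ : ∀ x → isCycleMin (τ ⊕ ρ) (x ↑ˡ m) ≡ isCycleMin τ x
      cycleMin-⊕ˡ x = isCycleMin-≡ σ-perm τ-perm
        (λ min t → subst₂ _≤_ (toℕ-iter-⊕ˡ 0 x) (toℕ-iter-⊕ˡ t x) (min t))
        (λ min t → subst₂ _≤_ (sym (toℕ-iter-⊕ˡ 0 x)) (sym (toℕ-iter-⊕ˡ t x)) (min t))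
      cycleMin-⊕ʳ : ∀ y → isCycleMin (τ ⊕ ρ) (p ↑ʳ y) ≡ isCycleMin ρ y
      cycleMin-⊕ʳ y = isCycleMin-≡ σ-perm ρ-perm
        (λ min t → +-cancelˡ-≤ p _ _ (subst₂ _≤_ (toℕ-iter-⊕ʳ 0 y) (toℕ-iter-⊕ʳ t y) (min t)))
        (λ min t → subst₂ _≤_ (sym (toℕ-iter-⊕ʳ 0 y)) (sym (toℕ-iter-⊕ʳ t y)) (+-monoʳ-≤ p (min t)))

    Closed-⊕⁻ : ∀ q → Closed (τ ⊕ ρ) q → Closed τ q
    Closed-⊕⁻ q closed x x<q = subst (_< q) (trans (cong toℕ (lookup-⊕ˡ x)) (Fin.toℕ-↑ˡ _ m))
      (closed (x ↑ˡ m) (subst (_< q) (sym (Fin.toℕ-↑ˡ x m)) x<q))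

    Closed-⊕⁺ : ∀ q → q ≤ p → Closed τ q → Closed (τ ⊕ ρ) q
    Closed-⊕⁺ q q≤p closed z z<q with splitView z
    ... | left x  = subst (_< q) (sym (trans (cong toℕ (lookup-⊕ˡ x)) (Fin.toℕ-↑ˡ _ m)))
                      (closed x (subst (_< q) (Fin.toℕ-↑ˡ x m) z<q))
    ... | right y = ⊥-elim (<⇒≱ z<q (≤-trans q≤p (≤-toℕ-↑ʳ y)))

  -- The fallbacks x and y are junk, reached only where σ crosses the boundary at p.
  restrictˡ-entry : Endo (p + m) → Fin p → Fin p
  restrictˡ-entry σ x = [ id , (λ _ → x) ]′ (splitAt p (lookup σ (x ↑ˡ m)))

  restrictʳ-entry : Endo (p + m) → Fin m → Fin m
  restrictʳ-entry σ y = [ (λ _ → y) , id ]′ (splitAt p (lookup σ (p ↑ʳ y)))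

  restrictˡ : Endo (p + m) → Endo p
  restrictˡ σ = tabulateᵛ (restrictˡ-entry σ)

  restrictʳ : Endo (p + m) → Endo m
  restrictʳ σ = tabulateᵛ (restrictʳ-entry σ)

  restrictˡ-⊕ : ∀ (τ : Endo p) (ρ : Endo m) → restrictˡ (τ ⊕ ρ) ≡ τ
  restrictˡ-⊕ τ ρ = lookup-ext entry
    where
    entry : ∀ x → lookup (restrictˡ (τ ⊕ ρ)) x ≡ lookup τ x
    entry x rewrite Vec.lookup∘tabulate (restrictˡ-entry (τ ⊕ ρ)) x | lookup-⊕ˡ τ ρ x
                  | Fin.splitAt-↑ˡ p (lookup τ x) m = refl

  restrictʳ-⊕ : ∀ (τ : Endo p) (ρ : Endo m) → restrictʳ (τ ⊕ ρ) ≡ ρ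
  restrictʳ-⊕ τ ρ = lookup-ext entry
    where
    entry : ∀ y → lookup (restrictʳ (τ ⊕ ρ)) y ≡ lookup ρ y
    entry y rewrite Vec.lookup∘tabulate (restrictʳ-entry (τ ⊕ ρ)) y | lookup-⊕ʳ τ ρ y
                  | Fin.splitAt-↑ʳ p m (lookup ρ y) = refl

  module _ {σ : Endo (p + m)} (σ-perm : IsPermutation σ) (p-closed : Closed σ p) where

    lookup-restrictˡ : ∀ x → lookup (restrictˡ σ) x ↑ˡ m ≡ lookup σ (x ↑ˡ m)
    lookup-restrictˡ x rewrite Vec.lookup∘tabulate (restrictˡ-entry σ) x with splitAt p (lookup σ (x ↑ˡ m)) in eq
    ... | inj₁ _ = Fin.splitAt⁻¹-↑ˡ eq
    ... | inj₂ y = ⊥-elim (<⇒≱ (p-closed (x ↑ˡ m) (toℕ-↑ˡ< x))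
                              (subst (λ z → p ≤ toℕ z) (Fin.splitAt⁻¹-↑ʳ eq) (≤-toℕ-↑ʳ y)))

    restrictˡ-permutation : IsPermutation (restrictˡ σ)
    restrictˡ-permutation {x} {x′} eq = Fin.↑ˡ-injective m _ _
      (σ-perm (trans (sym (lookup-restrictˡ x)) (trans (cong (_↑ˡ m) eq) (lookup-restrictˡ x′))))

    -- σ maps the first p points onto themselves, so it cannot send a later point there.
    lookup-restrictʳ : ∀ y → p ↑ʳ lookup (restrictʳ σ) y ≡ lookup σ (p ↑ʳ y)
    lookup-restrictʳ y rewrite Vec.lookup∘tabulate (restrictʳ-entry σ) y with splitAt p (lookup σ (p ↑ʳ y)) in eq
    ... | inj₂ _ = Fin.splitAt⁻¹-↑ʳ eq
    ... | inj₁ w with x , σx≡w ← injective⇒surjective restrictˡ-permutation w =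
      ⊥-elim (↑ˡ≢↑ʳ x y (σ-perm (trans (sym (lookup-restrictˡ x))
                                      (trans (cong (_↑ˡ m) σx≡w) (Fin.splitAt⁻¹-↑ˡ eq)))))

    restrictˡ⊕restrictʳ : restrictˡ σ ⊕ restrictʳ σ ≡ σ
    restrictˡ⊕restrictʳ = lookup-ext λ z → go z (splitView z)
      where
      go : ∀ z → SplitView z → lookup (restrictˡ σ ⊕ restrictʳ σ) z ≡ lookup σ z
      go _ (left x)  = trans (lookup-⊕ˡ (restrictˡ σ) (restrictʳ σ) x) (lookup-restrictˡ x)
      go _ (right y) = trans (lookup-⊕ʳ (restrictˡ σ) (restrictʳ σ) y) (lookup-restrictʳ y)

firstBlock-⊕ : ∀ {p m} (τ : Endo (suc p)) (ρ : Endo m) → Indecomposable τ → firstBlock (τ ⊕ ρ) ≡ suc p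
firstBlock-⊕ τ ρ τ-indec = firstBlock-unique (τ ⊕ ρ) _ (s≤s z≤n) (Closed-⊕⁺ τ ρ _ ≤-refl (Closed-n τ))
  λ q 1≤q q<p closed → τ-indec q 1≤q q<p (Closed-⊕⁻ τ ρ q closed)

-- Decomposition at the first block

permWithCycles : ∀ {n} → ℕ → Endo n → Bool
permWithCycles k σ = isPerm σ ∧ (numCycles σ ≡ᵇ k)

indecWithCycles : ∀ {n} → ℕ → Endo n → Bool
indecWithCycles k σ = isPerm σ ∧ (isIndecomposable σ ∧ (numCycles σ ≡ᵇ k))

permWithCycles⇔ : ∀ {n} k (σ : Endo n) → T (permWithCycles k σ) ⇔ (IsPermutation σ × numCycles σ ≡ k)
permWithCycles⇔ k σ = ⇔-trans T-∧ (isPerm⇔IsPermutation σ ×-⇔ ≡ᵇ⇔≡)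

indecWithCycles⇔ : ∀ {n} k (σ : Endo (suc n)) →
  T (indecWithCycles k σ) ⇔ (IsPermutation σ × Indecomposable σ × numCycles σ ≡ k)
indecWithCycles⇔ k σ =
  ⇔-trans T-∧ (isPerm⇔IsPermutation σ ×-⇔ ⇔-trans T-∧ (isIndecomposable⇔Indecomposable σ ×-⇔ ≡ᵇ⇔≡))

withFirstBlock : ∀ {n} → ℕ → ℕ → Endo n → Bool
withFirstBlock k p σ = permWithCycles k σ ∧ (firstBlock σ ≡ᵇ p)

withFirstBlock⇔ : ∀ {n} k p (σ : Endo n) →
  T (withFirstBlock k p σ) ⇔ ((IsPermutation σ × numCycles σ ≡ k) × firstBlock σ ≡ p)
withFirstBlock⇔ k p σ = ⇔-trans T-∧ (permWithCycles⇔ k σ ×-⇔ ≡ᵇ⇔≡)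

s≡count : ∀ m j → s m j ≡ count (permWithCycles j) (allVecs m m)
s≡count m j = trans (length-filter (λ σ → numCycles σ ≟ j) (perms m))
                    (count-filter isPerm (λ σ → numCycles σ ≡ᵇ j) (allVecs m m))

c≡count : ∀ n k → c n k ≡ count (indecWithCycles k) (allVecs n n)
c≡count n k = begin
  c n k
    ≡⟨ length-filter _ (perms n) ⟩
  count (λ σ → isIndecomposable σ ∧ ⌊ numCycles σ ≟ k ⌋) (perms n)
    ≡⟨ count-cong (perms n) (λ σ → cong (isIndecomposable σ ∧_) (isYes≗does (numCycles σ ≟ k))) ⟩
  count (λ σ → isIndecomposable σ ∧ (numCycles σ ≡ᵇ k)) (perms n)
    ≡⟨ count-filter isPerm _ (allVecs n n) ⟩
  count (indecWithCycles k) (allVecs n n) ∎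
  where open ≡-Reasoning

split-≡ᵇ : ∀ a b {k i} → i ≤ k → ((a + b) ≡ᵇ k) ∧ (a ≡ᵇ i) ≡ (a ≡ᵇ i) ∧ (b ≡ᵇ (k ∸ i))
split-≡ᵇ a b {k} {i} i≤k = T⇔T⇒≡ to from
  where
  ≡ᵇ-∧-≡ᵇ : ∀ {w x y z} → T ((w ≡ᵇ x) ∧ (y ≡ᵇ z)) ⇔ (w ≡ x × y ≡ z)
  ≡ᵇ-∧-≡ᵇ = ⇔-trans T-∧ (≡ᵇ⇔≡ ×-⇔ ≡ᵇ⇔≡)
  to : T (((a + b) ≡ᵇ k) ∧ (a ≡ᵇ i)) → T ((a ≡ᵇ i) ∧ (b ≡ᵇ (k ∸ i)))
  to t with refl , refl ← Equivalence.to (≡ᵇ-∧-≡ᵇ {a + b} {k} {a} {i}) t =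
    Equivalence.from (≡ᵇ-∧-≡ᵇ {a} {a} {b}) (refl , sym (m+n∸m≡n a b))
  from : T ((a ≡ᵇ i) ∧ (b ≡ᵇ (k ∸ i))) → T (((a + b) ≡ᵇ k) ∧ (a ≡ᵇ i))
  from t with refl , refl ← Equivalence.to (≡ᵇ-∧-≡ᵇ {a} {i} {b} {k ∸ i}) t =
    Equivalence.from (≡ᵇ-∧-≡ᵇ {a + (k ∸ a)} {k} {a}) (m+[n∸m]≡n i≤k , refl)

module _ {p m : ℕ} (k : ℕ) where

  private
    P = suc p

    blockPair : Endo P × Endo m → Bool
    blockPair (τ , ρ) = (isPerm τ ∧ isIndecomposable τ) ∧ (isPerm ρ ∧ ((numCycles τ + numCycles ρ) ≡ᵇ k))

    blockPair⇔ : ∀ τ ρ → T (blockPair (τ , ρ)) ⇔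
      ((IsPermutation τ × Indecomposable τ) × (IsPermutation ρ × numCycles τ + numCycles ρ ≡ k))
    blockPair⇔ τ ρ = ⇔-trans T-∧
      (  ⇔-trans T-∧ (isPerm⇔IsPermutation τ ×-⇔ isIndecomposable⇔Indecomposable τ)
      ×-⇔ ⇔-trans T-∧ (isPerm⇔IsPermutation ρ ×-⇔ ≡ᵇ⇔≡))

    blockPair-fibre : ∀ {i} → i ≤ k → ∀ τρ →
      blockPair τρ ∧ (numCycles (proj₁ τρ) ≡ᵇ i)
        ≡ indecWithCycles i (proj₁ τρ) ∧ permWithCycles (k ∸ i) (proj₂ τρ)
    blockPair-fibre i≤k (τ , ρ) with isPerm τ | isIndecomposable τ | isPerm ρ
    ... | false | _     | _     = refl
    ... | true  | false | _     = refl
    ... | true  | true  | false = sym (∧-zeroʳ _)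
    ... | true  | true  | true  = split-≡ᵇ (numCycles τ) (numCycles ρ) i≤k

    blockPair⇒ : ∀ τρ → T (blockPair τρ) →
      T (withFirstBlock k P (proj₁ τρ ⊕ proj₂ τρ))
    blockPair⇒ (τ , ρ) t with (τ-perm , τ-indec) , (ρ-perm , cycles) ← Equivalence.to (blockPair⇔ τ ρ) t =
      Equivalence.from (withFirstBlock⇔ k P (τ ⊕ ρ))
        ( (⊕-permutation τ ρ τ-perm ρ-perm , trans (numCycles-⊕ τ ρ τ-perm ρ-perm) cycles)
        , firstBlock-⊕ τ ρ τ-indec)

    module _ (σ : Endo (P + m)) (t : T (withFirstBlock k P σ)) where
      private
        σ-prop = Equivalence.to (withFirstBlock⇔ k P σ) t
        σ-perm = proj₁ (proj₁ σ-prop)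
        τ = restrictˡ {P} {m} σ
        ρ = restrictʳ {P} {m} σ

      restrict-⊕ : τ ⊕ ρ ≡ σ
      restrict-⊕ = restrictˡ⊕restrictʳ σ-perm (subst (Closed σ) (proj₂ σ-prop) (firstBlock-closed σ))

      private
        τρ-perm = ⊕-permutation⁻ τ ρ (subst IsPermutation (sym restrict-⊕) σ-perm)
        τ-indec : Indecomposable τ
        τ-indec q 1≤q q<P closed = firstBlock-minimal σ q 1≤q (subst (q <_) (sym (proj₂ σ-prop)) q<P)
          (subst (λ σ′ → Closed σ′ q) restrict-⊕ (Closed-⊕⁺ τ ρ q (<⇒≤ q<P) closed))

      ⇒blockPair : T (blockPair (τ , ρ))
      ⇒blockPair = Equivalence.from (blockPair⇔ τ ρ)
        ( (proj₁ τρ-perm , τ-indec)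
        , (proj₂ τρ-perm , trans (sym (numCycles-⊕ τ ρ (proj₁ τρ-perm) (proj₂ τρ-perm)))
                                 (trans (cong numCycles restrict-⊕) (proj₂ (proj₁ σ-prop)))))

  count-firstBlock-+ : count (withFirstBlock k P) (allVecs (P + m) (P + m))
                   ≡ sumFT 1 (k ⊓ P) (λ i → c P i * s m (k ∸ i))
  count-firstBlock-+ = begin
      count (withFirstBlock k P) (allVecs (P + m) (P + m))
    ≡⟨ count-bijection pairs-enumerate (allVecs-enumerates (P + m) (P + m)) blockPair _
         (λ τρ → proj₁ τρ ⊕ proj₂ τρ) (λ σ → restrictˡ σ , restrictʳ σ) blockPair⇒ ⇒blockPair
         (λ { (τ , ρ) _ → cong₂ _,_ (restrictˡ-⊕ τ ρ) (restrictʳ-⊕ τ ρ) }) restrict-⊕ ⟨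
      count blockPair pairs
    ≡⟨ count-fibres blockPair (numCycles ∘ proj₁) (interval-unique (k ⊓ P)) cycles∈ pairs ⟩
      sumFT 1 (k ⊓ P) (λ i → count (λ τρ → blockPair τρ ∧ (numCycles (proj₁ τρ) ≡ᵇ i)) pairs)
    ≡⟨ sum-map-cong (interval 1 (k ⊓ P)) fibre ⟩
      sumFT 1 (k ⊓ P) (λ i → c P i * s m (k ∸ i)) ∎
    where
    open ≡-Reasoning
    pairs = cartesianProduct (allVecs P P) (allVecs m m)
    pairs-enumerate = cartesianProduct-enumerates (allVecs-enumerates P P) (allVecs-enumerates m m)
    cycles∈ : ∀ τρ → T (blockPair τρ) → numCycles (proj₁ τρ) ∈ interval 1 (k ⊓ P)
    cycles∈ (τ , ρ) t with _ , (_ , cycles) ← Equivalence.to (blockPair⇔ τ ρ) t =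
      Equivalence.from ∈-interval
        (numCycles-pos τ , ⊓-glb (subst (numCycles τ ≤_) cycles (m≤m+n _ _)) (numCycles≤n τ))
    fibre : ∀ i → i ∈ interval 1 (k ⊓ P) →
      count (λ τρ → blockPair τρ ∧ (numCycles (proj₁ τρ) ≡ᵇ i)) pairs ≡ c P i * s m (k ∸ i)
    fibre i i∈ = begin
      count (λ τρ → blockPair τρ ∧ (numCycles (proj₁ τρ) ≡ᵇ i)) pairs
        ≡⟨ count-cong pairs (blockPair-fibre i≤k) ⟩
      count (λ τρ → indecWithCycles i (proj₁ τρ) ∧ permWithCycles (k ∸ i) (proj₂ τρ)) pairs
        ≡⟨ count-cartesianProduct (indecWithCycles i) (permWithCycles (k ∸ i)) (allVecs P P) (allVecs m m) ⟩
      count (indecWithCycles i) (allVecs P P) * count (permWithCycles (k ∸ i)) (allVecs m m)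
        ≡⟨ cong₂ _*_ (c≡count P i) (s≡count m (k ∸ i)) ⟨
      c P i * s m (k ∸ i) ∎
      where
      i≤k : i ≤ k
      i≤k = ≤-trans (proj₂ (Equivalence.to ∈-interval i∈)) (m⊓n≤m k P)

count-firstBlock : ∀ n k p → 1 ≤ p → p ≤ n →
  count (withFirstBlock k p) (allVecs n n) ≡ sumFT 1 (k ⊓ p) (λ i → c p i * s (n ∸ p) (k ∸ i))
count-firstBlock n k (suc p) _ p≤n = go (n ∸ suc p) (m+[n∸m]≡n p≤n)
  where
  go : ∀ m → suc p + m ≡ n →
    count (withFirstBlock k (suc p)) (allVecs n n) ≡ sumFT 1 (k ⊓ suc p) (λ i → c (suc p) i * s m (k ∸ i))
  go m refl = count-firstBlock-+ k

s≡sum-count-firstBlock : ∀ n k →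
  s (suc n) k ≡ sumFT 1 (suc n) (λ p → count (withFirstBlock k p) (allVecs (suc n) (suc n)))
s≡sum-count-firstBlock n k =
  trans (s≡count (suc n) k) (count-fibres (permWithCycles k) firstBlock (interval-unique (suc n))
    (λ σ _ → Equivalence.from ∈-interval (firstBlock-pos σ , firstBlock≤n σ)) (allVecs (suc n) (suc n)))

count-firstBlock-n≡c : ∀ n k → count (withFirstBlock k (suc n)) (allVecs (suc n) (suc n)) ≡ c (suc n) k
count-firstBlock-n≡c n k = trans (count-cong (allVecs (suc n) (suc n)) reorder) (sym (c≡count (suc n) k))
  where
  reorder : ∀ σ → withFirstBlock k (suc n) σ ≡ indecWithCycles k σ
  reorder σ = begin
    (isPerm σ ∧ (numCycles σ ≡ᵇ k)) ∧ (firstBlock σ ≡ᵇ suc n)  ≡⟨ ∧-assoc (isPerm σ) _ _ ⟩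
    isPerm σ ∧ ((numCycles σ ≡ᵇ k) ∧ (firstBlock σ ≡ᵇ suc n))  ≡⟨ cong (isPerm σ ∧_) (∧-comm (numCycles σ ≡ᵇ k) _) ⟩
    isPerm σ ∧ ((firstBlock σ ≡ᵇ suc n) ∧ (numCycles σ ≡ᵇ k))  ≡⟨ cong (λ b → isPerm σ ∧ (b ∧ (numCycles σ ≡ᵇ k)))
                                                                      (isIndecomposable≡firstBlock≡ᵇn σ) ⟨
    indecWithCycles k σ                                         ∎
    where open ≡-Reasoning

decomposition-identity : ∀ n k →
  c (suc n) k + sumFT 1 n (λ p → sumFT 1 (k ⊓ p) (λ i → c p i * s (suc n ∸ p) (k ∸ i))) ≡ s (suc n) k
decomposition-identity n k = sym (begin
    s (suc n) k
  ≡⟨ s≡sum-count-firstBlock n k ⟩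
    sumFT 1 (suc n) H
  ≡⟨ sumFT-suc n H ⟩
    sumFT 1 n H + H (suc n)
  ≡⟨ cong₂ _+_ (sum-map-cong (interval 1 n) proper) (count-firstBlock-n≡c n k) ⟩
    sumFT 1 n (λ p → sumFT 1 (k ⊓ p) (λ i → c p i * s (suc n ∸ p) (k ∸ i))) + c (suc n) k
  ≡⟨ +-comm _ (c (suc n) k) ⟩
    c (suc n) k + sumFT 1 n (λ p → sumFT 1 (k ⊓ p) (λ i → c p i * s (suc n ∸ p) (k ∸ i))) ∎)
  where
  open ≡-Reasoning
  H = λ p → count (withFirstBlock k p) (allVecs (suc n) (suc n))
  proper : ∀ p → p ∈ interval 1 n → H p ≡ sumFT 1 (k ⊓ p) (λ i → c p i * s (suc n ∸ p) (k ∸ i))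
  proper p p∈ with 1≤p , p≤n ← Equivalence.to ∈-interval p∈ =
    count-firstBlock (suc n) k p 1≤p (m≤n⇒m≤1+n p≤n)

-- Inserting the largest point into a cycle

top : ∀ {N} → Fin (suc N)
top = fromℕ _

lowerTop : ∀ {N} → Fin (suc N) → Fin N → Fin N
lowerTop z d with view z
... | ‵fromℕ     = d
... | ‵inject₁ y = y

lowerTop-inject₁ : ∀ {N} (y d : Fin N) → lowerTop (inject₁ y) d ≡ y
lowerTop-inject₁ y d rewrite view-inject₁ y = refl

inject₁-lowerTop : ∀ {N} {z : Fin (suc N)} (d : Fin N) → z ≢ top → inject₁ (lowerTop z d) ≡ z
inject₁-lowerTop {z = z} d z≢top with view z
... | ‵fromℕ     = ⊥-elim (z≢top refl)
... | ‵inject₁ _ = refl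

toℕ-inject₁< : ∀ {N} (y : Fin N) → toℕ (inject₁ y) < N
toℕ-inject₁< y = subst (_< _) (sym (Fin.toℕ-inject₁ y)) (Fin.toℕ<n y)

module _ {N : ℕ} where

  insertAt : Endo N → Fin N → (z : Fin (suc N)) → View z → Fin (suc N)
  insertAt σ x _ ‵fromℕ        = inject₁ (lookup σ x)
  insertAt σ x _ (‵inject₁ y) = if ⌊ y Fin.≟ x ⌋ then top else inject₁ (lookup σ y)

  -- N is spliced into the cycle of x, right after x.
  insert : Endo N → Fin N → Endo (suc N)
  insert σ x = tabulateᵛ λ z → insertAt σ x z (view z)

  module _ (σ : Endo N) (x : Fin N) where

    private
      σ⁺ = insert σ x

    lookup-insert-top : lookup σ⁺ top ≡ inject₁ (lookup σ x)
    lookup-insert-top rewrite Vec.lookup∘tabulate (λ z → insertAt σ x z (view z)) top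
                            | view-fromℕ N = refl

    lookup-insert-x : lookup σ⁺ (inject₁ x) ≡ top
    lookup-insert-x rewrite Vec.lookup∘tabulate (λ z → insertAt σ x z (view z)) (inject₁ x)
                          | view-inject₁ x with x Fin.≟ x
    ... | yes _   = refl
    ... | no x≢x = ⊥-elim (x≢x refl)

    lookup-insert-other : ∀ {y} → y ≢ x → lookup σ⁺ (inject₁ y) ≡ inject₁ (lookup σ y)
    lookup-insert-other {y} y≢x rewrite Vec.lookup∘tabulate (λ z → insertAt σ x z (view z)) (inject₁ y)
                                      | view-inject₁ y with y Fin.≟ x
    ... | yes y≡x = ⊥-elim (y≢x y≡x)
    ... | no _    = refl

    lookup-insert-inject₁ : ∀ y → (y ≡ x × lookup σ⁺ (inject₁ y) ≡ top)
                                ⊎ (y ≢ x × lookup σ⁺ (inject₁ y) ≡ inject₁ (lookup σ y))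
    lookup-insert-inject₁ y with y Fin.≟ x
    ... | yes refl = inj₁ (refl , lookup-insert-x)
    ... | no y≢x   = inj₂ (y≢x , lookup-insert-other y≢x)

    private
      top≢inject₁ : ∀ (y : Fin N) → top ≢ inject₁ y
      top≢inject₁ y = Fin.fromℕ≢inject₁

      lookup-top≢ : IsPermutation σ → ∀ y → lookup σ⁺ top ≢ lookup σ⁺ (inject₁ y)
      lookup-top≢ σ-perm y eq with lookup-insert-inject₁ y
      ... | inj₁ (refl , σ⁺y≡top) = top≢inject₁ _ (sym (trans (sym lookup-insert-top) (trans eq σ⁺y≡top)))
      ... | inj₂ (y≢x , σ⁺y≡σy)  = y≢x (sym (σ-perm (Fin.inject₁-injective
                                      (trans (sym lookup-insert-top) (trans eq σ⁺y≡σy)))))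

    insert-permutation : IsPermutation σ → IsPermutation σ⁺
    insert-permutation σ-perm {z₁} {z₂} eq with view z₁ | view z₂
    ... | ‵fromℕ      | ‵fromℕ      = refl
    ... | ‵fromℕ      | ‵inject₁ y₂ = ⊥-elim (lookup-top≢ σ-perm y₂ eq)
    ... | ‵inject₁ y₁ | ‵fromℕ      = ⊥-elim (lookup-top≢ σ-perm y₁ (sym eq))
    ... | ‵inject₁ y₁ | ‵inject₁ y₂ with lookup-insert-inject₁ y₁ | lookup-insert-inject₁ y₂
    ...   | inj₁ (refl , _)   | inj₁ (refl , _)   = refl
    ...   | inj₁ (refl , e₁)  | inj₂ (_ , e₂)     = ⊥-elim (top≢inject₁ _ (trans (sym e₁) (trans eq e₂)))
    ...   | inj₂ (_ , e₁)     | inj₁ (refl , e₂)  = ⊥-elim (top≢inject₁ _ (trans (sym e₂) (trans (sym eq) e₁)))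
    ...   | inj₂ (_ , e₁)     | inj₂ (_ , e₂)     =
      cong inject₁ (σ-perm (Fin.inject₁-injective (trans (sym e₁) (trans eq e₂))))

    insert-permutation⁻ : IsPermutation σ⁺ → IsPermutation σ
    insert-permutation⁻ σ⁺-perm {y₁} {y₂} eq with lookup-insert-inject₁ y₁ | lookup-insert-inject₁ y₂
    ... | inj₁ (refl , _)  | inj₁ (refl , _)  = refl
    ... | inj₁ (refl , _)  | inj₂ (_ , e₂)    =
      ⊥-elim (top≢inject₁ y₂ (σ⁺-perm (trans lookup-insert-top (trans (cong inject₁ eq) (sym e₂)))))
    ... | inj₂ (_ , e₁)    | inj₁ (refl , _)  =
      ⊥-elim (top≢inject₁ y₁ (σ⁺-perm (trans lookup-insert-top (trans (cong inject₁ (sym eq)) (sym e₁)))))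
    ... | inj₂ (_ , e₁)    | inj₂ (_ , e₂)    =
      Fin.inject₁-injective (σ⁺-perm (trans e₁ (trans (cong inject₁ eq) (sym e₂))))

    -- Orbits of σ⁺ are those of σ, with N visited right after x.
    iter-insert-forward : ∀ y t → ∃ λ t′ → iter σ⁺ t′ (inject₁ y) ≡ inject₁ (iter σ t y)
    iter-insert-forward y zero = zero , refl
    iter-insert-forward y (suc t) with t′ , eq ← iter-insert-forward y t
                                 with lookup-insert-inject₁ (iter σ t y)
    ... | inj₁ (σᵗy≡x , e) = suc (suc t′) , (begin
      lookup σ⁺ (lookup σ⁺ (iter σ⁺ t′ (inject₁ y))) ≡⟨ cong (lookup σ⁺ ∘ lookup σ⁺) eq ⟩
      lookup σ⁺ (lookup σ⁺ (inject₁ (iter σ t y)))   ≡⟨ cong (lookup σ⁺) e ⟩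
      lookup σ⁺ top                                  ≡⟨ lookup-insert-top ⟩
      inject₁ (lookup σ x)                           ≡⟨ cong (inject₁ ∘ lookup σ) σᵗy≡x ⟨
      inject₁ (lookup σ (iter σ t y))                ∎)
      where open ≡-Reasoning
    ... | inj₂ (_ , e) = suc t′ , trans (cong (lookup σ⁺) eq) e

    iter-insert-backward : ∀ y t → (∃ λ t′ → iter σ⁺ t (inject₁ y) ≡ inject₁ (iter σ t′ y))
                                 ⊎ (iter σ⁺ t (inject₁ y) ≡ top × ∃ λ t′ → iter σ t′ y ≡ x)
    iter-insert-backward y zero = inj₁ (zero , refl)
    iter-insert-backward y (suc t) with iter-insert-backward y t
    ... | inj₁ (t′ , eq) with lookup-insert-inject₁ (iter σ t′ y)
    ...   | inj₁ (σᵗ′y≡x , e) = inj₂ (trans (cong (lookup σ⁺) eq) e , t′ , σᵗ′y≡x)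
    ...   | inj₂ (_ , e)      = inj₁ (suc t′ , trans (cong (lookup σ⁺) eq) e)
    iter-insert-backward y (suc t) | inj₂ (eq , t′ , σᵗ′y≡x) =
      inj₁ (suc t′ , trans (cong (lookup σ⁺) eq)
                           (trans lookup-insert-top (cong (inject₁ ∘ lookup σ) (sym σᵗ′y≡x))))

    CycleMin-insert⁻ : ∀ y → CycleMin σ⁺ (inject₁ y) → CycleMin σ y
    CycleMin-insert⁻ y min t with t′ , eq ← iter-insert-forward y t =
      subst₂ _≤_ (Fin.toℕ-inject₁ y) (trans (cong toℕ eq) (Fin.toℕ-inject₁ _)) (min t′)

    CycleMin-insert⁺ : ∀ y → CycleMin σ y → CycleMin σ⁺ (inject₁ y)
    CycleMin-insert⁺ y min t with iter-insert-backward y t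
    ... | inj₁ (t′ , eq)  = subst₂ _≤_ (sym (Fin.toℕ-inject₁ y))
                                       (sym (trans (cong toℕ eq) (Fin.toℕ-inject₁ _))) (min t′)
    ... | inj₂ (eq , _)   = subst (toℕ (inject₁ y) ≤_) (sym (trans (cong toℕ eq) (Fin.toℕ-fromℕ N)))
                              (<⇒≤ (toℕ-inject₁< y))

    top-not-CycleMin : ¬ CycleMin σ⁺ top
    top-not-CycleMin min = <⇒≱ (toℕ-inject₁< (lookup σ x))
      (subst₂ _≤_ (Fin.toℕ-fromℕ N) (cong toℕ lookup-insert-top) (min 1))

    numCycles-insert : IsPermutation σ → numCycles σ⁺ ≡ numCycles σ
    numCycles-insert σ-perm = begin
        numCycles σ⁺
      ≡⟨ numCycles≡count σ⁺ ⟩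
        count (isCycleMin σ⁺) (allFin (suc N))
      ≡⟨ count-allFin-suc N (isCycleMin σ⁺) ⟩
        count (isCycleMin σ⁺ ∘ inject₁) (allFin N) + indicator (isCycleMin σ⁺ top)
      ≡⟨ cong₂ _+_ (count-cong (allFin N) λ y →
                      isCycleMin-≡ σ⁺-perm σ-perm (CycleMin-insert⁻ y) (CycleMin-insert⁺ y))
                   top-uncounted ⟩
        count (isCycleMin σ) (allFin N) + 0
      ≡⟨ +-identityʳ _ ⟩
        count (isCycleMin σ) (allFin N)
      ≡⟨ numCycles≡count σ ⟨
        numCycles σ ∎
      where
      open ≡-Reasoning
      σ⁺-perm = insert-permutation σ-perm
      top-uncounted : indicator (isCycleMin σ⁺ top) ≡ 0
      top-uncounted with isCycleMin σ⁺ top in eq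
      ... | false = refl
      ... | true  = ⊥-elim (top-not-CycleMin (isCycleMin⇒CycleMin σ⁺-perm (subst T (sym eq) _)))

module _ {N : ℕ} (σ : Endo (suc N)) (x : Fin (suc N)) where

  private
    σ⁺ = insert σ x

    Closed-insert⁻ : ∀ {q} → q ≤ toℕ x → Closed σ⁺ q → Closed σ q
    Closed-insert⁻ {q} q≤x closed y y<q with lookup-insert-inject₁ σ x y
    ... | inj₁ (refl , _) = ⊥-elim (<⇒≱ y<q q≤x)
    ... | inj₂ (_ , e)    = subst (_< q) (trans (cong toℕ e) (Fin.toℕ-inject₁ _))
                               (closed (inject₁ y) (subst (_< q) (sym (Fin.toℕ-inject₁ y)) y<q))

    Closed-insert⁺ : ∀ {q} → q ≤ toℕ x → Closed σ q → Closed σ⁺ q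
    Closed-insert⁺ {q} q≤x closed z z<q with view z
    ... | ‵fromℕ = ⊥-elim (<⇒≱ z<q (≤-trans q≤x (subst (toℕ x ≤_) (sym (Fin.toℕ-fromℕ _)) (<⇒≤ (Fin.toℕ<n x)))))
    ... | ‵inject₁ y with lookup-insert-inject₁ σ x y
    ...   | inj₁ (refl , _) = ⊥-elim (<⇒≱ (subst (_< q) (Fin.toℕ-inject₁ x) z<q) q≤x)
    ...   | inj₂ (_ , e)    = subst (_< q) (sym (trans (cong toℕ e) (Fin.toℕ-inject₁ _)))
                                 (closed y (subst (_< q) (Fin.toℕ-inject₁ y) z<q))

  -- A prefix of σ⁺ containing x is never closed, as x ↦ N; one avoiding x is closed iff it is for σ.
  Indecomposable-insert : Indecomposable σ⁺ ⇔ toℕ x < firstBlock σ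
  Indecomposable-insert = mk⇔ to from
    where
    to : Indecomposable σ⁺ → toℕ x < firstBlock σ
    to indec with toℕ x <? firstBlock σ
    ... | yes x<fb = x<fb
    ... | no x≮fb  = ⊥-elim (indec (firstBlock σ) (firstBlock-pos σ)
        (≤-<-trans fb≤x (≤-trans (Fin.toℕ<n x) (n≤1+n _)))
        (Closed-insert⁺ fb≤x (firstBlock-closed σ)))
      where fb≤x = ≮⇒≥ x≮fb
    from : toℕ x < firstBlock σ → Indecomposable σ⁺
    from x<fb q 1≤q q<N closed with toℕ x <? q
    ... | yes x<q = <⇒≱ (subst (_< q) (trans (cong toℕ (lookup-insert-x σ x)) (Fin.toℕ-fromℕ _))
                          (closed (inject₁ x) (subst (_< q) (sym (Fin.toℕ-inject₁ x)) x<q)))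
                        (s≤s⁻¹ q<N)
    ... | no x≮q  = firstBlock-minimal σ q 1≤q (≤-<-trans q≤x x<fb) (Closed-insert⁻ q≤x closed)
      where q≤x = ≮⇒≥ x≮q

module _ {N′ : ℕ} where

  private
    N = suc N′

  bypassTop : Endo (suc N) → Fin (suc N) → Fin (suc N)
  bypassTop σ z = if ⌊ lookup σ z Fin.≟ top ⌋ then lookup σ top else lookup σ z

  remove : Endo (suc N) → Endo N
  remove σ = tabulateᵛ λ y → lowerTop (bypassTop σ (inject₁ y)) y

  -- zero is a junk value, used only when no point below N is sent to N.
  topPreimage : Endo (suc N) → Fin N
  topPreimage σ with Fin.any? (λ y → lookup σ (inject₁ y) Fin.≟ top)
  ... | yes (y , _) = y
  ... | no _        = zero

  module _ (σ : Endo (suc N)) where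

    lookup-remove : ∀ y → lookup (remove σ) y ≡ lowerTop (bypassTop σ (inject₁ y)) y
    lookup-remove y = Vec.lookup∘tabulate (λ y → lowerTop (bypassTop σ (inject₁ y)) y) y

    bypassTop-top : ∀ z → lookup σ z ≡ top → bypassTop σ z ≡ lookup σ top
    bypassTop-top z eq with lookup σ z Fin.≟ top
    ... | yes _   = refl
    ... | no  neq = ⊥-elim (neq eq)

    bypassTop-other : ∀ z → lookup σ z ≢ top → bypassTop σ z ≡ lookup σ z
    bypassTop-other z neq with lookup σ z Fin.≟ top
    ... | yes eq = ⊥-elim (neq eq)
    ... | no _   = refl

    lookup-topPreimage : (∃ λ y → lookup σ (inject₁ y) ≡ top) → lookup σ (inject₁ (topPreimage σ)) ≡ top
    lookup-topPreimage hit with Fin.any? (λ y → lookup σ (inject₁ y) Fin.≟ top)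
    ... | yes (_ , eq) = eq
    ... | no miss      = ⊥-elim (miss hit)

  remove-insert : ∀ σ x → remove (insert σ x) ≡ σ
  remove-insert σ x = lookup-ext λ y → trans (lookup-remove (insert σ x) y) (go y)
    where
    go : ∀ y → lowerTop (bypassTop (insert σ x) (inject₁ y)) y ≡ lookup σ y
    go y with lookup-insert-inject₁ σ x y
    ... | inj₁ (refl , e) rewrite bypassTop-top (insert σ x) (inject₁ y) e | lookup-insert-top σ x =
      lowerTop-inject₁ _ y
    ... | inj₂ (_ , e) rewrite bypassTop-other (insert σ x) (inject₁ y) (λ e′ → Fin.fromℕ≢inject₁ (trans (sym e′) e))
                             | e = lowerTop-inject₁ _ y

  topPreimage-insert : ∀ {σ} x → IsPermutation σ → topPreimage (insert σ x) ≡ x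
  topPreimage-insert {σ} x σ-perm = Fin.inject₁-injective (insert-permutation σ x σ-perm
    (trans (lookup-topPreimage (insert σ x) (x , lookup-insert-x σ x)) (sym (lookup-insert-x σ x))))

  insert-remove : ∀ {σ} → IsPermutation σ → lookup σ top ≢ top → insert (remove σ) (topPreimage σ) ≡ σ
  insert-remove {σ} σ-perm σtop≢top = lookup-ext go
    where
    hit : ∃ λ y → lookup σ (inject₁ y) ≡ top
    hit with z , σz≡top ← injective⇒surjective σ-perm top with view z
    ... | ‵fromℕ     = ⊥-elim (σtop≢top σz≡top)
    ... | ‵inject₁ y = y , σz≡top
    x = topPreimage σ
    σx≡top : lookup σ (inject₁ x) ≡ top
    σx≡top = lookup-topPreimage σ hit
    moved : ∀ {y} → y ≢ x → lookup σ (inject₁ y) ≢ top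
    moved y≢x σy≡top = y≢x (Fin.inject₁-injective (σ-perm (trans σy≡top (sym σx≡top))))
    go : ∀ z → lookup (insert (remove σ) x) z ≡ lookup σ z
    go z with view z
    ... | ‵fromℕ rewrite lookup-insert-top (remove σ) x | lookup-remove σ x
                       | bypassTop-top σ (inject₁ x) σx≡top = inject₁-lowerTop x σtop≢top
    ... | ‵inject₁ y with lookup-insert-inject₁ (remove σ) x y
    ...   | inj₁ (refl , e) = trans e (sym σx≡top)
    ...   | inj₂ (y≢x , e) rewrite e | lookup-remove σ y | bypassTop-other σ (inject₁ y) (moved y≢x) =
      inject₁-lowerTop y (moved y≢x)

Indecomposable⇒top-moved : ∀ {N} (σ : Endo (suc (suc N))) → IsPermutation σ → Indecomposable σ →
                           lookup σ top ≢ top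
Indecomposable⇒top-moved {N} σ σ-perm indec σtop≡top = indec (suc N) (s≤s z≤n) ≤-refl below-top-closed
  where
  below-top-closed : Closed σ (suc N)
  below-top-closed z z<N with m≤n⇒m<n∨m≡n (s≤s⁻¹ (Fin.toℕ<n (lookup σ z)))
  ... | inj₁ σz<N = σz<N
  ... | inj₂ σz≡N = ⊥-elim (<-irrefl (trans (cong toℕ z≡top) (Fin.toℕ-fromℕ _)) z<N)
    where
    z≡top : z ≡ top
    z≡top = σ-perm (trans (Fin.toℕ-injective (trans σz≡N (sym (Fin.toℕ-fromℕ _)))) (sym σtop≡top))

module _ {N′ : ℕ} (k : ℕ) where

  private
    N = suc N′

  insertPair : Endo N × Fin N → Bool
  insertPair (σ , x) = permWithCycles k σ ∧ (toℕ x <ᵇ firstBlock σ)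

  private
    insertPair⇔ : ∀ σ x →
      T (insertPair (σ , x)) ⇔ ((IsPermutation σ × numCycles σ ≡ k) × toℕ x < firstBlock σ)
    insertPair⇔ σ x = ⇔-trans T-∧ (permWithCycles⇔ k σ ×-⇔ mk⇔ (<ᵇ⇒< (toℕ x) (firstBlock σ)) <⇒<ᵇ)

    insertPair⇒ : ∀ σx → T (insertPair σx) → T (indecWithCycles k (insert (proj₁ σx) (proj₂ σx)))
    insertPair⇒ (σ , x) t with (σ-perm , cycles) , x<fb ← Equivalence.to (insertPair⇔ σ x) t =
      Equivalence.from (indecWithCycles⇔ k (insert σ x))
        ( insert-permutation σ x σ-perm
        , Equivalence.from (Indecomposable-insert σ x) x<fb
        , trans (numCycles-insert σ x σ-perm) cycles)

    module _ (σ : Endo (suc N)) (t : T (indecWithCycles k σ)) where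
      private
        σ-prop = Equivalence.to (indecWithCycles⇔ k σ) t
        σ-perm = proj₁ σ-prop
        σ-indec = proj₁ (proj₂ σ-prop)

      reinsert : insert (remove σ) (topPreimage σ) ≡ σ
      reinsert = insert-remove σ-perm (Indecomposable⇒top-moved σ σ-perm σ-indec)

      private
        remove-perm = insert-permutation⁻ (remove σ) (topPreimage σ) (subst IsPermutation (sym reinsert) σ-perm)

      ⇒insertPair : T (insertPair (remove σ , topPreimage σ))
      ⇒insertPair = Equivalence.from (insertPair⇔ (remove σ) (topPreimage σ))
        ( ( remove-perm
          , trans (sym (numCycles-insert (remove σ) (topPreimage σ) remove-perm))
                  (trans (cong numCycles reinsert) (proj₂ (proj₂ σ-prop))))
        , Equivalence.to (Indecomposable-insert (remove σ) (topPreimage σ))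
                         (subst Indecomposable (sym reinsert) σ-indec))

  c≡count-insertPair : c (suc N) k ≡ count insertPair (cartesianProduct (allVecs N N) (allFin N))
  c≡count-insertPair = trans (c≡count (suc N) k)
    (count-bijection (allVecs-enumerates (suc N) (suc N))
      (cartesianProduct-enumerates (allVecs-enumerates N N) (allFin-enumerates N))
      (indecWithCycles k) insertPair (λ σ → remove σ , topPreimage σ) (λ σx → insert (proj₁ σx) (proj₂ σx))
      ⇒insertPair insertPair⇒ reinsert
      λ { (σ , x) t → cong₂ _,_ (remove-insert σ x)
            (topPreimage-insert x (proj₁ (proj₁ (Equivalence.to (insertPair⇔ σ x) t)))) })

<ᵇ-fibre : ∀ b m f p → (b ∧ (m <ᵇ f)) ∧ (f ≡ᵇ p) ≡ (b ∧ (f ≡ᵇ p)) ∧ (m <ᵇ p)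
<ᵇ-fibre false m f p = refl
<ᵇ-fibre true  m f p with f ≡ᵇ p in eq
... | true  rewrite ≡ᵇ⇒≡ f p (subst T (sym eq) _) = ∧-identityʳ (m <ᵇ p)
... | false = ∧-zeroʳ (m <ᵇ f)

insertion-identity : ∀ N′ k → let N = suc N′ in
  c (suc N) k ≡ sumFT 1 N (λ p → sumFT 1 (k ⊓ p) (λ i → p * c p i * s (suc N ∸ p ∸ 1) (k ∸ i)))
insertion-identity N′ k = begin
    c (suc N) k
  ≡⟨ c≡count-insertPair {N′} k ⟩
    count (insertPair {N′} k) pairs
  ≡⟨ count-fibres (insertPair {N′} k) (firstBlock ∘ proj₁) (interval-unique N)
       (λ σx _ → Equivalence.from ∈-interval (firstBlock-pos (proj₁ σx) , firstBlock≤n (proj₁ σx))) pairs ⟩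
    sumFT 1 N (λ p → count (λ σx → insertPair {N′} k σx ∧ (firstBlock (proj₁ σx) ≡ᵇ p)) pairs)
  ≡⟨ sum-map-cong (interval 1 N) fibre ⟩
    sumFT 1 N (λ p → sumFT 1 (k ⊓ p) (λ i → p * c p i * s (suc N ∸ p ∸ 1) (k ∸ i))) ∎
  where
  open ≡-Reasoning
  N = suc N′
  pairs = cartesianProduct (allVecs N N) (allFin N)
  fibre : ∀ p → p ∈ interval 1 N → count (λ σx → insertPair {N′} k σx ∧ (firstBlock (proj₁ σx) ≡ᵇ p)) pairs
                                 ≡ sumFT 1 (k ⊓ p) (λ i → p * c p i * s (suc N ∸ p ∸ 1) (k ∸ i))
  fibre p p∈ with 1≤p , p≤N ← Equivalence.to ∈-interval p∈ = begin
      count (λ σx → insertPair {N′} k σx ∧ (firstBlock (proj₁ σx) ≡ᵇ p)) pairs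
    ≡⟨ count-cong pairs (λ (σ , x) → <ᵇ-fibre (permWithCycles k σ) (toℕ x) (firstBlock σ) p) ⟩
      count (λ σx → withFirstBlock k p (proj₁ σx) ∧ (toℕ (proj₂ σx) <ᵇ p)) pairs
    ≡⟨ count-cartesianProduct (withFirstBlock k p) (λ x → toℕ x <ᵇ p) (allVecs N N) (allFin N) ⟩
      count (withFirstBlock k p) (allVecs N N) * count (λ x → toℕ x <ᵇ p) (allFin N)
    ≡⟨ cong₂ _*_ (count-firstBlock N k p 1≤p p≤N) (count-toℕ< N p p≤N) ⟩
      sumFT 1 (k ⊓ p) (λ i → c p i * s (N ∸ p) (k ∸ i)) * p
    ≡⟨ *-comm _ p ⟩
      p * sumFT 1 (k ⊓ p) (λ i → c p i * s (N ∸ p) (k ∸ i))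
    ≡⟨ sum-map-*ˡ p (λ i → c p i * s (N ∸ p) (k ∸ i)) (interval 1 (k ⊓ p)) ⟨
      sumFT 1 (k ⊓ p) (λ i → p * (c p i * s (N ∸ p) (k ∸ i)))
    ≡⟨ sum-map-cong (interval 1 (k ⊓ p)) (λ i _ → sym (*-assoc p (c p i) _)) ⟩
      sumFT 1 (k ⊓ p) (λ i → p * c p i * s (N ∸ p) (k ∸ i))
    ≡⟨ cong (λ m → sumFT 1 (k ⊓ p) (λ i → p * c p i * s m (k ∸ i))) N∸p≡N+1∸p∸1 ⟩
      sumFT 1 (k ⊓ p) (λ i → p * c p i * s (suc N ∸ p ∸ 1) (k ∸ i)) ∎
    where
    N∸p≡N+1∸p∸1 : N ∸ p ≡ suc N ∸ p ∸ 1
    N∸p≡N+1∸p∸1 = sym (trans (∸-+-assoc (suc N) p 1) (cong (suc N ∸_) (+-comm p 1)))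

proposition2 : (n k : ℕ) → 1 < n → 1 ≤ k →
    (c n k + sumFT 1 (n ∸ 1) (λ p → sumFT 1 (k ⊓ p) (λ i → c p i * s (n ∸ p) (k ∸ i))) ≡ s n k)
    × (c n k ≡ sumFT 1 (n ∸ 1) (λ p → sumFT 1 (k ⊓ p) (λ i → p * c p i * s (n ∸ p ∸ 1) (k ∸ i))))
proposition2 (suc (suc n)) k (s≤s (s≤s z≤n)) _ = decomposition-identity (suc n) k , insertion-identity n k
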